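{- Let $z$ be an indeterminate. For every $n\ge1$, in $\mathbb{Q}(z)$, $$\sum_{F\in F(n)}\prod_{h\in\mathcal{H}(F)}\frac{(h-1)!}{h\,(h-2+z)_{h-2}}=z\,(n+z-1)_{n-1},$$ where $(x)_m=x(x-1)\cdots(x-m+1)$ is the falling factorial.
   Context: $F(n)$ is the set of labeled forests on $\{1,\dots,n\}$, i.e. sets of rooted labeled trees (children unordered) whose vertex sets partition $\{1,\dots,n\}$. For a vertex $u$ of $F$, the hook length $h_u$ is the number of descendants of $u$ (counting $u$ itself), and $\mathcal{H}(F)$ is the multiset of hook lengths of all vertices; the product is over all vertices. Falling factorial: $(x)_m=x(x-1)\cdots(x-m+1)$ for $m\ge1$, $(x)_0=1$, and $(x)_{ -1}=1/(x+1)$ (so for $h=1$, $(z-1)_{ -1}=1/z$). -}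

module Defs where

open import Data.Nat as ℕ using (ℕ; zero; suc)
open import Data.Nat using (_!)
open import Data.Integer using (+_)
open import Data.Rational using (ℚ; 0ℚ; 1ℚ; _+_; _*_; _-_; 1/_; _/_; ≢-nonZero)
open import Data.Rational.Properties using (_≟_)
open import Data.Fin using (Fin)
open import Data.Fin.Properties as FinP using ()
open import Data.Maybe using (Maybe; just; nothing)
open import Data.Vec using (Vec; []; _∷_; lookup)
open import Data.List using (List; []; _∷_; map; concatMap; filter; foldr; allFin; upTo; length)
open import Data.Bool using (Bool; true; false)
open import Relation.Nullary using (yes; no; Dec)
open import Relation.Nullary.Decidable using (⌊_⌋)
open import Data.List.Relation.Unary.All using (All; all?)
open import Data.List.Relation.Unary.Any using (Any; any?)
open import Relation.Binary.PropositionalEquality using (_≡_)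
import Data.Maybe.Properties as MaybeP

ℕ→ℚ : ℕ → ℚ
ℕ→ℚ n = + n / 1

-- total inverse on ℚ (1/0 := 0); only used where the argument is nonzero
inv : ℚ → ℚ
inv q with q ≟ 0ℚ
... | yes _  = 0ℚ
... | no q≢0 = 1/_ q {{≢-nonZero q≢0}}

ff : ℚ → ℕ → ℚ
ff x zero    = 1ℚ
ff x (suc m) = x * ff (x - 1ℚ) m

-- ffm1 x m = (x)_{m-1}, with the convention (x)_{-1} = 1/(x+1)
ffm1 : ℚ → ℕ → ℚ
ffm1 x zero    = inv (x + 1ℚ)
ffm1 x (suc m) = ff x m

-- Labeled rooted forests on {1..n} (here Fin n), encoded by their parent
-- function: p v = nothing if v is a root, just u if u is the parent of v.
-- A parent function describes a forest iff it is acyclic, i.e. iterating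
-- it n times from any vertex reaches "nothing".

ParentFn : ℕ → Set
ParentFn n = Vec (Maybe (Fin n)) n

step : ∀ {n} → ParentFn n → Maybe (Fin n) → Maybe (Fin n)
step p nothing  = nothing
step p (just v) = lookup p v

iter : ∀ {n} → ParentFn n → ℕ → Maybe (Fin n) → Maybe (Fin n)
iter p zero    m = m
iter p (suc k) m = iter p k (step p m)

_≟M_ : ∀ {n} (a b : Maybe (Fin n)) → Dec (a ≡ b)
_≟M_ = MaybeP.≡-dec FinP._≟_

isForest : ∀ {n} → ParentFn n → Bool
isForest {n} p = ⌊ all? (λ v → iter p n (just v) ≟M nothing) (allFin n) ⌋

allVecs : ∀ {A : Set} (k : ℕ) → List A → List (Vec A k)
allVecs zero    xs = [] ∷ []
allVecs (suc k) xs = concatMap (λ x → map (x ∷_) (allVecs k xs)) xs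

allParentFns : (n : ℕ) → List (ParentFn n)
allParentFns n = allVecs n (nothing ∷ map just (allFin n))

forests : (n : ℕ) → List (ParentFn n)
forests n = filter (λ p → isForest p ≟B true) (allParentFns n)
  where
  _≟B_ : (a b : Bool) → Dec (a ≡ b)
  _≟B_ = Data.Bool._≟_
    where import Data.Bool

isDesc : ∀ {n} → ParentFn n → Fin n → Fin n → Set
isDesc {n} p u v = Any (λ k → iter p k (just v) ≡ just u) (upTo (suc n))

hook : ∀ {n} → ParentFn n → Fin n → ℕ
hook {n} p u = length (filter (λ v → any? (λ k → iter p k (just v) ≟M just u) (upTo (suc n))) (allFin n))

-- the weight (h-1)! / (h (h-2+z)_{h-2}) of a hook length h ≥ 1
hookWeight : ℚ → ℕ → ℚ
hookWeight z zero    = 0ℚ   -- never used: hook lengths are ≥ 1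
hookWeight z (suc k) = ℕ→ℚ (k !) * inv (ℕ→ℚ (suc k) * ffm1 (z + ℕ→ℚ k - 1ℚ) k)

sumℚ : List ℚ → ℚ
sumℚ = foldr _+_ 0ℚ

prodℚ : List ℚ → ℚ
prodℚ = foldr _*_ 1ℚ

lhs : ℚ → ℕ → ℚ
lhs z n = sumℚ (map (λ p → prodℚ (map (λ u → hookWeight z (hook p u)) (allFin n))) (forests n))

rhs : ℚ → ℕ → ℚ
rhs z n = z * ff (ℕ→ℚ n + z - 1ℚ) (n ℕ.∸ 1)

-- Write Φ(S) for the sum, over the forests on a vertex set S, of the product of the hook
-- weights w(h) = (h-1)! / (h (h-2+z)_{h-2}), and fix s ∈ S.  A forest on S is the same as a
-- tree T ∋ s with a root r, a forest on T ∖ {r} (the subtrees below r) and a forest on S ∖ T;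
-- the hook of r is |T| and all other hooks are unchanged.  Hence
--   Φ(S) = Σ_{s ∈ T ⊆ S} Σ_{r ∈ T} w(|T|) Φ(T ∖ {r}) Φ(S ∖ T).
-- With the rising factorial z↑k = z(z+1)⋯(z+k-1), induction on |S| gives Φ(S) = z↑|S|: the
-- sum over r contributes |T| w(|T|) z↑(|T|-1) = z (|T|-1)! = z 1↑(|T|-1), and what remains
-- is Vandermonde's identity Σ_{s ∈ T ⊆ S} 1↑(|T|-1) z↑|S ∖ T| = (1+z)↑(|S|-1).
-- Finally z↑n = z (n+z-1)_{n-1}.

module Submission where

module HookLengthForests where

  open import Defs
  open import Data.Bool using (Bool; true; false; if_then_else_)
  import Data.Bool.Properties as BoolP
  open import Data.Empty using (⊥-elim)
  open import Data.Unit using (⊤; tt)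
  open import Data.Fin as Fin using (Fin)
  import Data.Fin.Properties as FinP
  open import Data.Fin.Subset using (Subset; inside; outside; ∣_∣; _─_; ⁅_⁆; _∈_; _∉_; _⊆_)
    renaming (⊤ to ⊤ˢ)
  open import Data.Fin.Subset.Properties
    using (_∈?_; _⊆?_; drop-there; drop-∷-⊆; x∈⁅y⁆⇒x≡y; ∣⁅x⁆∣≡1; x∈p⇒∣p-x∣<∣p∣; p─q⊆p;
           x∈p∧x∉q⇒x∈p─q; x∈p∩q⁺; p∩q≢∅⇒∣p─q∣<∣p∣;
           x∈p∧x≢y⇒x∈p-y; x∉⁅y⁆⇒x≢y; ⊆-antisym; ∈⊤;
           nonempty?; Empty-unique; ∣⊥∣≡0; ∣p∣≤n; p⊆q⇒∣p∣≤∣q∣; ∣⊤∣≡n)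
  import Data.Integer as ℤ
  import Data.Integer.Solver as ℤSolver
  open import Data.List as List using (List; []; _∷_; _++_; map; concatMap; filter; cartesianProduct; allFin; tabulate)
  open import Data.Maybe using (Maybe; just; nothing; fromMaybe)
  open import Data.Nat as ℕ using (ℕ; zero; suc; _!; _∸_; _≤_; _<_; z≤n; s≤s)
  import Data.Nat.Coprimality as Coprimality
  import Data.Nat.Properties as ℕP
  open import Data.Nat.Induction using (<-wellFounded)
  open import Induction.WellFounded using (Acc; acc)
  import Data.List.Relation.Unary.All as All
  import Data.List.Relation.Unary.Any as Any
  open import Data.List.Membership.Propositional using (lose)
  import Data.List.Membership.Propositional.Properties as ∈P
  open import Data.Product using (_×_; _,_; proj₁; proj₂; ∃; ∃₂; uncurry)
  import Data.Product.Properties as ×P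
  open import Data.Rational using (ℚ; 0ℚ; 1ℚ; _+_; _*_; _-_; mkℚ; toℚᵘ; ≢-nonZero)
  import Data.Rational.Properties as ℚP
  open import Data.Rational.Solver using (module +-*-Solver)
  import Data.Rational.Unnormalised as ℚᵘ
  import Data.Rational.Unnormalised.Properties as ℚᵘP
  open import Data.Vec as Vec using (Vec; []; _∷_; lookup; here; there)
  import Data.Vec.Properties as VecP
  import Data.List.Properties as ListP
  import Function.Properties.Equivalence as ⇔
  open import Function using (id; _∘_; _⇔_; mk⇔; Equivalence)
  open import Relation.Binary.Definitions using (DecidableEquality)
  open import Relation.Binary.PropositionalEquality
  open import Relation.Nullary using (Dec; yes; no; does; ¬_; _×-dec_; contradiction)
  open import Relation.Nullary.Decidable using (dec-true; dec-false; map′; toWitness; fromWitness; decidable-stable)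
  import Relation.Nullary.Decidable as Dec
  open import Relation.Unary using (Decidable)
  import Data.Maybe.Properties as MaybeP
  open +-*-Solver

  ℕ→ℚ-mkℚ : ∀ k → ℕ→ℚ k ≡ mkℚ (ℤ.+ k) 0 (Coprimality.sym (Coprimality.1-coprimeTo k))
  ℕ→ℚ-mkℚ k = ℚP.normalize-coprime (Coprimality.sym (Coprimality.1-coprimeTo k))

  ℕ→ℚ-suc : ∀ m → ℕ→ℚ (suc m) ≡ 1ℚ + ℕ→ℚ m
  ℕ→ℚ-suc m = ℚP.toℚᵘ-injective (ℚᵘP.≃-trans numerators (ℚᵘP.≃-sym (ℚP.toℚᵘ-homo-+ 1ℚ (ℕ→ℚ m))))
    where
    open ℤSolver.+-*-Solver using () renaming (solve to solveℤ; _:+_ to _⊕_; _:*_ to _⊗_; _:=_ to _≐_; con to c)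
    numerators : toℚᵘ (ℕ→ℚ (suc m)) ℚᵘ.≃ (toℚᵘ 1ℚ ℚᵘ.+ toℚᵘ (ℕ→ℚ m))
    numerators rewrite ℕ→ℚ-mkℚ (suc m) | ℕ→ℚ-mkℚ m = ℚᵘ.*≡*
      (solveℤ 1 (λ x → (c (ℤ.+ 1) ⊕ x) ⊗ (c (ℤ.+ 1) ⊗ c (ℤ.+ 1))
                    ≐ (c (ℤ.+ 1) ⊗ c (ℤ.+ 1) ⊕ x ⊗ c (ℤ.+ 1)) ⊗ c (ℤ.+ 1))
              refl (ℤ.+ m))

  ℕ→ℚ-+ : ∀ m n → ℕ→ℚ (m ℕ.+ n) ≡ ℕ→ℚ m + ℕ→ℚ n
  ℕ→ℚ-+ zero    n = sym (ℚP.+-identityˡ (ℕ→ℚ n))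
  ℕ→ℚ-+ (suc m) n = begin
    ℕ→ℚ (suc (m ℕ.+ n))      ≡⟨ ℕ→ℚ-suc (m ℕ.+ n) ⟩
    1ℚ + ℕ→ℚ (m ℕ.+ n)       ≡⟨ cong (1ℚ +_) (ℕ→ℚ-+ m n) ⟩
    1ℚ + (ℕ→ℚ m + ℕ→ℚ n)     ≡⟨ ℚP.+-assoc 1ℚ (ℕ→ℚ m) (ℕ→ℚ n) ⟨
    (1ℚ + ℕ→ℚ m) + ℕ→ℚ n     ≡⟨ cong (_+ ℕ→ℚ n) (ℕ→ℚ-suc m) ⟨
    ℕ→ℚ (suc m) + ℕ→ℚ n      ∎
    where open ≡-Reasoning

  ℕ→ℚ-* : ∀ m n → ℕ→ℚ (m ℕ.* n) ≡ ℕ→ℚ m * ℕ→ℚ n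
  ℕ→ℚ-* zero    n = sym (ℚP.*-zeroˡ (ℕ→ℚ n))
  ℕ→ℚ-* (suc m) n = begin
    ℕ→ℚ (n ℕ.+ m ℕ.* n)       ≡⟨ ℕ→ℚ-+ n (m ℕ.* n) ⟩
    ℕ→ℚ n + ℕ→ℚ (m ℕ.* n)     ≡⟨ cong (ℕ→ℚ n +_) (ℕ→ℚ-* m n) ⟩
    ℕ→ℚ n + ℕ→ℚ m * ℕ→ℚ n     ≡⟨ solve 2 (λ a b → b :+ a :* b := (con 1ℚ :+ a) :* b) refl (ℕ→ℚ m) (ℕ→ℚ n) ⟩
    (1ℚ + ℕ→ℚ m) * ℕ→ℚ n      ≡⟨ cong (_* ℕ→ℚ n) (ℕ→ℚ-suc m) ⟨
    ℕ→ℚ (suc m) * ℕ→ℚ n       ∎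
    where open ≡-Reasoning

  ℕ→ℚ-suc≢0 : ∀ k → ℕ→ℚ (suc k) ≢ 0ℚ
  ℕ→ℚ-suc≢0 k eq with trans (sym (ℕ→ℚ-mkℚ (suc k))) eq
  ... | ()

  inv-inverseˡ : ∀ q → q ≢ 0ℚ → inv q * q ≡ 1ℚ
  inv-inverseˡ q q≢0 with q ℚP.≟ 0ℚ
  ... | yes q≡0  = ⊥-elim (q≢0 q≡0)
  ... | no  q≢0′ = ℚP.*-inverseˡ q {{≢-nonZero q≢0′}}

  *-cancelˡ-≢0 : ∀ p q → p ≢ 0ℚ → p * q ≡ 0ℚ → q ≡ 0ℚ
  *-cancelˡ-≢0 p q p≢0 pq≡0 = begin
    q                ≡⟨ ℚP.*-identityˡ q ⟨
    1ℚ * q           ≡⟨ cong (_* q) (inv-inverseˡ p p≢0) ⟨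
    (inv p * p) * q  ≡⟨ ℚP.*-assoc (inv p) p q ⟩
    inv p * (p * q)  ≡⟨ cong (inv p *_) pq≡0 ⟩
    inv p * 0ℚ       ≡⟨ ℚP.*-zeroʳ (inv p) ⟩
    0ℚ               ∎
    where open ≡-Reasoning

  *-≢0 : ∀ p q → p ≢ 0ℚ → q ≢ 0ℚ → p * q ≢ 0ℚ
  *-≢0 p q p≢0 q≢0 pq≡0 = q≢0 (*-cancelˡ-≢0 p q p≢0 pq≡0)

  inv-≢0 : ∀ q → q ≢ 0ℚ → inv q ≢ 0ℚ
  inv-≢0 q q≢0 inv≡0 = ℚP.1≢0 (trans (sym (inv-inverseˡ q q≢0)) (trans (cong (_* q) inv≡0) (ℚP.*-zeroˡ q)))

  inv-involutive : ∀ q → inv (inv q) ≡ q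
  inv-involutive q = by-cases (q ℚP.≟ 0ℚ)
    where
    open ≡-Reasoning
    by-cases : Dec (q ≡ 0ℚ) → inv (inv q) ≡ q
    by-cases (yes refl) = refl
    by-cases (no q≢0)   = begin
      inv (inv q)                ≡⟨ ℚP.*-identityʳ (inv (inv q)) ⟨
      inv (inv q) * 1ℚ           ≡⟨ cong (inv (inv q) *_) (inv-inverseˡ q q≢0) ⟨
      inv (inv q) * (inv q * q)  ≡⟨ ℚP.*-assoc (inv (inv q)) (inv q) q ⟨
      (inv (inv q) * inv q) * q  ≡⟨ cong (_* q) (inv-inverseˡ (inv q) (inv-≢0 q q≢0)) ⟩
      1ℚ * q                     ≡⟨ ℚP.*-identityˡ q ⟩
      q                          ∎

  -- Rising factorials

  infixl 8 _↑_

  _↑_ : ℚ → ℕ → ℚ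
  x ↑ zero  = 1ℚ
  x ↑ suc k = x * (x + 1ℚ) ↑ k

  ↑-suc-last : ∀ x m → x ↑ suc m ≡ x ↑ m * (x + ℕ→ℚ m)
  ↑-suc-last x zero    = solve 1 (λ a → a :* con 1ℚ := con 1ℚ :* (a :+ con 0ℚ)) refl x
  ↑-suc-last x (suc m) = begin
    x * (x + 1ℚ) ↑ suc m                        ≡⟨ cong (x *_) (↑-suc-last (x + 1ℚ) m) ⟩
    x * ((x + 1ℚ) ↑ m * ((x + 1ℚ) + ℕ→ℚ m))     ≡⟨ cong (λ t → x * ((x + 1ℚ) ↑ m * t)) shift ⟩
    x * ((x + 1ℚ) ↑ m * (x + ℕ→ℚ (suc m)))      ≡⟨ ℚP.*-assoc x _ _ ⟨
    x * (x + 1ℚ) ↑ m * (x + ℕ→ℚ (suc m))        ∎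
    where
    open ≡-Reasoning
    shift : (x + 1ℚ) + ℕ→ℚ m ≡ x + ℕ→ℚ (suc m)
    shift rewrite ℕ→ℚ-suc m = ℚP.+-assoc x 1ℚ (ℕ→ℚ m)

  ff≡↑ : ∀ x m → ff (x + ℕ→ℚ m) m ≡ (x + 1ℚ) ↑ m
  ff≡↑ x zero    = refl
  ff≡↑ x (suc m) = begin
    (x + ℕ→ℚ (suc m)) * ff (x + ℕ→ℚ (suc m) - 1ℚ) m  ≡⟨ cong (λ t → (x + ℕ→ℚ (suc m)) * ff t m) lower ⟩
    (x + ℕ→ℚ (suc m)) * ff (x + ℕ→ℚ m) m             ≡⟨ cong ((x + ℕ→ℚ (suc m)) *_) (ff≡↑ x m) ⟩
    (x + ℕ→ℚ (suc m)) * (x + 1ℚ) ↑ m                 ≡⟨ commute ⟩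
    (x + 1ℚ) ↑ m * ((x + 1ℚ) + ℕ→ℚ m)                ≡⟨ ↑-suc-last (x + 1ℚ) m ⟨
    (x + 1ℚ) ↑ suc m                                  ∎
    where
    open ≡-Reasoning
    lower : x + ℕ→ℚ (suc m) - 1ℚ ≡ x + ℕ→ℚ m
    lower rewrite ℕ→ℚ-suc m = solve 2 (λ a b → (a :+ (con 1ℚ :+ b)) :- con 1ℚ := a :+ b) refl x (ℕ→ℚ m)
    commute : (x + ℕ→ℚ (suc m)) * (x + 1ℚ) ↑ m ≡ (x + 1ℚ) ↑ m * ((x + 1ℚ) + ℕ→ℚ m)
    commute rewrite ℕ→ℚ-suc m = solve 3 (λ a b r → (a :+ (con 1ℚ :+ b)) :* r := r :* ((a :+ con 1ℚ) :+ b)) refl x (ℕ→ℚ m) ((x + 1ℚ) ↑ m)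

  rhs≡↑ : ∀ z m → rhs z (suc m) ≡ z ↑ suc m
  rhs≡↑ z m = cong (z *_) (trans (cong (λ t → ff t m) reorder) (ff≡↑ z m))
    where
    reorder : ℕ→ℚ (suc m) + z - 1ℚ ≡ z + ℕ→ℚ m
    reorder rewrite ℕ→ℚ-suc m = solve 2 (λ a b → ((con 1ℚ :+ b) :+ a) :- con 1ℚ := a :+ b) refl z (ℕ→ℚ m)

  1↑≡! : ∀ k → 1ℚ ↑ k ≡ ℕ→ℚ (k !)
  1↑≡! zero    = refl
  1↑≡! (suc k) = begin
    1ℚ ↑ suc k                   ≡⟨ ↑-suc-last 1ℚ k ⟩
    1ℚ ↑ k * (1ℚ + ℕ→ℚ k)        ≡⟨ cong₂ _*_ (sym (1↑≡! k)) (ℕ→ℚ-suc k) ⟨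
    ℕ→ℚ (k !) * ℕ→ℚ (suc k)      ≡⟨ ℚP.*-comm (ℕ→ℚ (k !)) (ℕ→ℚ (suc k)) ⟩
    ℕ→ℚ (suc k) * ℕ→ℚ (k !)      ≡⟨ ℕ→ℚ-* (suc k) (k !) ⟨
    ℕ→ℚ (suc k ℕ.* k !)          ∎
    where open ≡-Reasoning

  ↑-≢0 : ∀ z m → (∀ j → 1 ≤ j → j ≤ m → z + ℕ→ℚ j ≢ 0ℚ) → (z + 1ℚ) ↑ m ≢ 0ℚ
  ↑-≢0 z zero    _      ()
  ↑-≢0 z (suc m) z+j≢0 eq = *-≢0 _ _
    (↑-≢0 z m (λ j 1≤j j≤m → z+j≢0 j 1≤j (ℕP.m≤n⇒m≤1+n j≤m)))
    (λ last≡0 → z+j≢0 (suc m) (s≤s z≤n) ℕP.≤-refl (trans (sym shift) last≡0))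
    (trans (sym (↑-suc-last (z + 1ℚ) m)) eq)
    where
    shift : (z + 1ℚ) + ℕ→ℚ m ≡ z + ℕ→ℚ (suc m)
    shift rewrite ℕ→ℚ-suc m = ℚP.+-assoc z 1ℚ (ℕ→ℚ m)

  ↑-pascal : ∀ x y c → x * (x + 1ℚ + y) ↑ c + y * (x + (y + 1ℚ)) ↑ c ≡ (x + y) ↑ suc c
  ↑-pascal x y c = begin
    x * (x + 1ℚ + y) ↑ c + y * (x + (y + 1ℚ)) ↑ c  ≡⟨ cong₂ (λ a b → x * a ↑ c + y * b ↑ c) left right ⟩
    x * (x + y + 1ℚ) ↑ c + y * (x + y + 1ℚ) ↑ c    ≡⟨ ℚP.*-distribʳ-+ ((x + y + 1ℚ) ↑ c) x y ⟨
    (x + y) * (x + y + 1ℚ) ↑ c                      ∎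
    where
    open ≡-Reasoning
    left : x + 1ℚ + y ≡ x + y + 1ℚ
    left = solve 2 (λ a b → a :+ con 1ℚ :+ b := a :+ b :+ con 1ℚ) refl x y
    right : x + (y + 1ℚ) ≡ x + y + 1ℚ
    right = sym (ℚP.+-assoc x y 1ℚ)

  hookWeight-↑ : ∀ z k → (∀ j → 1 ≤ j → suc j ≤ k → z + ℕ→ℚ j ≢ 0ℚ) →
                 hookWeight z (suc k) * (ℕ→ℚ (suc k) * z ↑ k) ≡ z * ℕ→ℚ (k !)
  hookWeight-↑ z zero _ = begin
    1ℚ * inv (1ℚ * inv (z + 0ℚ - 1ℚ + 1ℚ)) * (1ℚ * 1ℚ)  ≡⟨ cong (λ t → 1ℚ * inv (1ℚ * inv t) * (1ℚ * 1ℚ)) cancel ⟩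
    1ℚ * inv (1ℚ * inv z) * (1ℚ * 1ℚ)                    ≡⟨ cong (λ t → 1ℚ * inv t * (1ℚ * 1ℚ)) (ℚP.*-identityˡ (inv z)) ⟩
    1ℚ * inv (inv z) * (1ℚ * 1ℚ)                         ≡⟨ cong (λ t → 1ℚ * t * (1ℚ * 1ℚ)) (inv-involutive z) ⟩
    1ℚ * z * (1ℚ * 1ℚ)                                   ≡⟨ solve 1 (λ a → con 1ℚ :* a :* (con 1ℚ :* con 1ℚ) := a :* con 1ℚ) refl z ⟩
    z * 1ℚ                                               ∎
    where
    open ≡-Reasoning
    cancel : z + 0ℚ - 1ℚ + 1ℚ ≡ z
    cancel = solve 1 (λ a → a :+ con 0ℚ :- con 1ℚ :+ con 1ℚ := a) refl z
  hookWeight-↑ z (suc k) z+j≢0 = begin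
    ℕ→ℚ (suc k !) * inv (k+2 * ff (z + ℕ→ℚ (suc k) - 1ℚ) k) * (k+2 * (z * P))
      ≡⟨ cong (λ t → ℕ→ℚ (suc k !) * inv (k+2 * t) * (k+2 * (z * P))) (trans (cong (λ t → ff t k) lower) (ff≡↑ z k)) ⟩
    ℕ→ℚ (suc k !) * inv c * (k+2 * (z * P))
      ≡⟨ solve 5 (λ f i n a p → f :* i :* (n :* (a :* p)) := a :* f :* (i :* (n :* p))) refl (ℕ→ℚ (suc k !)) (inv c) k+2 z P ⟩
    z * ℕ→ℚ (suc k !) * (inv c * c)  ≡⟨ cong (z * ℕ→ℚ (suc k !) *_) (inv-inverseˡ c c≢0) ⟩
    z * ℕ→ℚ (suc k !) * 1ℚ           ≡⟨ ℚP.*-identityʳ _ ⟩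
    z * ℕ→ℚ (suc k !)                ∎
    where
    open ≡-Reasoning
    k+2 P c : ℚ
    k+2 = ℕ→ℚ (suc (suc k))
    P = (z + 1ℚ) ↑ k
    c = k+2 * P
    lower : z + ℕ→ℚ (suc k) - 1ℚ ≡ z + ℕ→ℚ k
    lower rewrite ℕ→ℚ-suc k = solve 2 (λ a b → (a :+ (con 1ℚ :+ b)) :- con 1ℚ := a :+ b) refl z (ℕ→ℚ k)
    c≢0 : c ≢ 0ℚ
    c≢0 = *-≢0 _ _ (ℕ→ℚ-suc≢0 (suc k)) (↑-≢0 z k (λ j 1≤j j≤k → z+j≢0 j 1≤j (s≤s j≤k)))

  -- Finite sums, indicators and enumerations

  private variable
    A B P Q : Set

  ∑ : List A → (A → ℚ) → ℚ
  ∑ xs f = sumℚ (map f xs)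

  ∏ : List A → (A → ℚ) → ℚ
  ∏ xs f = prodℚ (map f xs)

  ∑-cong : ∀ (xs : List A) {f g : A → ℚ} → (∀ x → f x ≡ g x) → ∑ xs f ≡ ∑ xs g
  ∑-cong []       f≗g = refl
  ∑-cong (x ∷ xs) f≗g = cong₂ _+_ (f≗g x) (∑-cong xs f≗g)

  ∑-++ : ∀ (xs ys : List A) f → ∑ (xs ++ ys) f ≡ ∑ xs f + ∑ ys f
  ∑-++ []       ys f = sym (ℚP.+-identityˡ _)
  ∑-++ (x ∷ xs) ys f = trans (cong (f x +_) (∑-++ xs ys f)) (sym (ℚP.+-assoc (f x) (∑ xs f) (∑ ys f)))

  ∑-map : ∀ (h : B → A) (xs : List B) f → ∑ (map h xs) f ≡ ∑ xs (λ x → f (h x))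
  ∑-map h []       f = refl
  ∑-map h (x ∷ xs) f = cong (f (h x) +_) (∑-map h xs f)

  ∑-concatMap : ∀ (h : B → List A) (xs : List B) f →
                ∑ (concatMap h xs) f ≡ ∑ xs (λ x → ∑ (h x) f)
  ∑-concatMap h []       f = refl
  ∑-concatMap h (x ∷ xs) f = trans (∑-++ (h x) (concatMap h xs) f) (cong (∑ (h x) f +_) (∑-concatMap h xs f))

  ∑-zero : ∀ (xs : List A) → ∑ xs (λ _ → 0ℚ) ≡ 0ℚ
  ∑-zero []       = refl
  ∑-zero (x ∷ xs) = trans (ℚP.+-identityˡ _) (∑-zero xs)

  ∑-+ : ∀ (xs : List A) f g → ∑ xs (λ x → f x + g x) ≡ ∑ xs f + ∑ xs g
  ∑-+ []       f g = sym (ℚP.+-identityˡ 0ℚ)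
  ∑-+ (x ∷ xs) f g = trans (cong ((f x + g x) +_) (∑-+ xs f g))
    (solve 4 (λ a b c d → (a :+ b) :+ (c :+ d) := (a :+ c) :+ (b :+ d)) refl (f x) (g x) (∑ xs f) (∑ xs g))

  *-∑ : ∀ (xs : List A) c f → c * ∑ xs f ≡ ∑ xs (λ x → c * f x)
  *-∑ []       c f = ℚP.*-zeroʳ c
  *-∑ (x ∷ xs) c f = trans (ℚP.*-distribˡ-+ c (f x) (∑ xs f)) (cong (c * f x +_) (*-∑ xs c f))

  ∑-* : ∀ (xs : List A) c f → ∑ xs f * c ≡ ∑ xs (λ x → f x * c)
  ∑-* xs c f = trans (ℚP.*-comm (∑ xs f) c) (trans (*-∑ xs c f) (∑-cong xs (λ x → ℚP.*-comm c (f x))))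

  ∑-swap : ∀ (xs : List A) (ys : List B) (f : A → B → ℚ) →
           ∑ xs (λ x → ∑ ys (f x)) ≡ ∑ ys (λ y → ∑ xs (λ x → f x y))
  ∑-swap []       ys f = sym (∑-zero ys)
  ∑-swap (x ∷ xs) ys f = trans (cong (∑ ys (f x) +_) (∑-swap xs ys f)) (sym (∑-+ ys (f x) (λ y → ∑ xs (λ x′ → f x′ y))))

  ∏-cong : ∀ (xs : List A) {f g : A → ℚ} → (∀ x → f x ≡ g x) → ∏ xs f ≡ ∏ xs g
  ∏-cong []       f≗g = refl
  ∏-cong (x ∷ xs) f≗g = cong₂ _*_ (f≗g x) (∏-cong xs f≗g)

  ∏-* : ∀ (xs : List A) f g → ∏ xs (λ x → f x * g x) ≡ ∏ xs f * ∏ xs g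
  ∏-* []       f g = refl
  ∏-* (x ∷ xs) f g = trans (cong ((f x * g x) *_) (∏-* xs f g))
    (solve 4 (λ a b c d → (a :* b) :* (c :* d) := (a :* c) :* (b :* d)) refl (f x) (g x) (∏ xs f) (∏ xs g))

  ∏-one : ∀ (xs : List A) → ∏ xs (λ _ → 1ℚ) ≡ 1ℚ
  ∏-one []       = refl
  ∏-one (x ∷ xs) = trans (ℚP.*-identityˡ _) (∏-one xs)

  ∑-*-∑ : ∀ (xs : List A) (ys : List B) f g → ∑ xs f * ∑ ys g ≡ ∑ xs (λ a → ∑ ys (λ b → f a * g b))
  ∑-*-∑ xs ys f g = trans (∑-* xs (∑ ys g) f) (∑-cong xs (λ a → *-∑ ys (f a) g))

  ∑-cartesianProduct : ∀ (xs : List A) (ys : List B) f →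
                       ∑ (cartesianProduct xs ys) f ≡ ∑ xs (λ x → ∑ ys (λ y → f (x , y)))
  ∑-cartesianProduct []       ys f = refl
  ∑-cartesianProduct (x ∷ xs) ys f = begin
    ∑ (map (x ,_) ys ++ cartesianProduct xs ys) f              ≡⟨ ∑-++ (map (x ,_) ys) _ f ⟩
    ∑ (map (x ,_) ys) f + ∑ (cartesianProduct xs ys) f        ≡⟨ cong₂ _+_ (∑-map (x ,_) ys f) (∑-cartesianProduct xs ys f) ⟩
    ∑ ys (λ y → f (x , y)) + ∑ xs (λ x → ∑ ys (λ y → f (x , y))) ∎
    where open ≡-Reasoning

  ∑-allVecs : ∀ k (xs : List A) f →
              ∑ (allVecs (suc k) xs) f ≡ ∑ xs (λ x → ∑ (allVecs k xs) (λ v → f (x ∷ v)))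
  ∑-allVecs k xs f = trans (∑-concatMap _ xs f) (∑-cong xs (λ x → ∑-map (x ∷_) (allVecs k xs) f))

  ∑-allFin-suc : ∀ n (f : Fin (suc n) → ℚ) → ∑ (allFin (suc n)) f ≡ f Fin.zero + ∑ (allFin n) (f ∘ Fin.suc)
  ∑-allFin-suc n f = cong (λ xs → f Fin.zero + sumℚ xs)
    (trans (ListP.map-tabulate Fin.suc f) (sym (ListP.map-tabulate id (f ∘ Fin.suc))))

  ∏-allFin-suc : ∀ n (f : Fin (suc n) → ℚ) → ∏ (allFin (suc n)) f ≡ f Fin.zero * ∏ (allFin n) (f ∘ Fin.suc)
  ∏-allFin-suc n f = cong (λ xs → f Fin.zero * prodℚ xs)
    (trans (ListP.map-tabulate Fin.suc f) (sym (ListP.map-tabulate id (f ∘ Fin.suc))))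

  ∏-allFin-single : ∀ n (r : Fin n) c (g : Fin n → ℚ) → (∀ i → i ≢ r → g i ≡ 1ℚ) → g r ≡ c →
                    ∏ (allFin n) g ≡ c
  ∏-allFin-single (suc n) Fin.zero c g g≡1 gr≡c = begin
    ∏ (allFin (suc n)) g                  ≡⟨ ∏-allFin-suc n g ⟩
    g Fin.zero * ∏ (allFin n) (g ∘ Fin.suc) ≡⟨ cong₂ _*_ gr≡c (∏-cong (allFin n) (λ i → g≡1 (Fin.suc i) λ ())) ⟩
    c * ∏ (allFin n) (λ _ → 1ℚ)           ≡⟨ cong (c *_) (∏-one (allFin n)) ⟩
    c * 1ℚ                                ≡⟨ ℚP.*-identityʳ c ⟩
    c                                     ∎
    where open ≡-Reasoning
  ∏-allFin-single (suc n) (Fin.suc r) c g g≡1 gr≡c = begin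
    ∏ (allFin (suc n)) g                    ≡⟨ ∏-allFin-suc n g ⟩
    g Fin.zero * ∏ (allFin n) (g ∘ Fin.suc) ≡⟨ cong₂ _*_ (g≡1 Fin.zero λ ()) (∏-allFin-single n r c (g ∘ Fin.suc) g∘suc≡1 gr≡c) ⟩
    1ℚ * c                                  ≡⟨ ℚP.*-identityˡ c ⟩
    c                                       ∎
    where
    open ≡-Reasoning
    g∘suc≡1 : ∀ i → i ≢ r → g (Fin.suc i) ≡ 1ℚ
    g∘suc≡1 i i≢r = g≡1 (Fin.suc i) (i≢r ∘ FinP.suc-injective)

  𝟙 : Dec P → ℚ
  𝟙 P? = if does P? then 1ℚ else 0ℚ

  _^⟦_⟧ : ℚ → Dec P → ℚ
  x ^⟦ P? ⟧ = if does P? then x else 1ℚ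

  𝟙-yes : (P? : Dec P) → P → 𝟙 P? ≡ 1ℚ
  𝟙-yes P? p rewrite dec-true P? p = refl

  𝟙-no : (P? : Dec P) → ¬ P → 𝟙 P? ≡ 0ℚ
  𝟙-no P? ¬p rewrite dec-false P? ¬p = refl

  𝟙-⇔ : (P? : Dec P) (Q? : Dec Q) → P ⇔ Q → 𝟙 P? ≡ 𝟙 Q?
  𝟙-⇔ P? (yes q) P⇔Q = 𝟙-yes P? (Equivalence.from P⇔Q q)
  𝟙-⇔ P? (no ¬q) P⇔Q = 𝟙-no P? (¬q ∘ Equivalence.to P⇔Q)

  𝟙-× : (P? : Dec P) (Q? : Dec Q) → 𝟙 (P? ×-dec Q?) ≡ 𝟙 P? * 𝟙 Q?
  𝟙-× (yes _) Q? = sym (ℚP.*-identityˡ (𝟙 Q?))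
  𝟙-× (no _)  Q? = sym (ℚP.*-zeroˡ (𝟙 Q?))

  𝟙-guard : (P? : Dec P) {x y : ℚ} → (P → x ≡ y) → 𝟙 P? * x ≡ 𝟙 P? * y
  𝟙-guard (yes p) x≡y = cong (1ℚ *_) (x≡y p)
  𝟙-guard (no _)  {x} {y} _ = trans (ℚP.*-zeroˡ x) (sym (ℚP.*-zeroˡ y))

  ^⟦⟧-yes : ∀ x (P? : Dec P) → P → x ^⟦ P? ⟧ ≡ x
  ^⟦⟧-yes x P? p rewrite dec-true P? p = refl

  ^⟦⟧-no : ∀ x (P? : Dec P) → ¬ P → x ^⟦ P? ⟧ ≡ 1ℚ
  ^⟦⟧-no x P? ¬p rewrite dec-false P? ¬p = refl

  ^⟦⟧-⇔ : ∀ x (P? : Dec P) (Q? : Dec Q) → P ⇔ Q → x ^⟦ P? ⟧ ≡ x ^⟦ Q? ⟧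
  ^⟦⟧-⇔ x P? (yes q) P⇔Q = ^⟦⟧-yes x P? (Equivalence.from P⇔Q q)
  ^⟦⟧-⇔ x P? (no ¬q) P⇔Q = ^⟦⟧-no x P? (¬q ∘ Equivalence.to P⇔Q)

  ∑-filter : ∀ {R : A → Set} (R? : Decidable R) (xs : List A) f → ∑ (filter R? xs) f ≡ ∑ xs (λ x → 𝟙 (R? x) * f x)
  ∑-filter R? []       f = refl
  ∑-filter R? (x ∷ xs) f with R? x
  ... | yes _ = cong₂ _+_ (sym (ℚP.*-identityˡ (f x))) (∑-filter R? xs f)
  ... | no  _ = trans (∑-filter R? xs f) (sym (trans (cong (_+ _) (ℚP.*-zeroˡ (f x))) (ℚP.+-identityˡ _)))

  Enumerates : DecidableEquality A → List A → Set
  Enumerates _≟_ xs = ∀ a → ∑ xs (λ x → 𝟙 (x ≟ a)) ≡ 1ℚ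

  ∑-δ : (_≟_ : DecidableEquality A) (xs : List A) → Enumerates _≟_ xs →
        ∀ a (f : A → ℚ) → ∑ xs (λ x → 𝟙 (x ≟ a) * f x) ≡ f a
  ∑-δ _≟_ xs enum a f = begin
    ∑ xs (λ x → 𝟙 (x ≟ a) * f x)   ≡⟨ ∑-cong xs (λ x → 𝟙-guard (x ≟ a) (cong f)) ⟩
    ∑ xs (λ x → 𝟙 (x ≟ a) * f a)   ≡⟨ ∑-* xs (f a) (λ x → 𝟙 (x ≟ a)) ⟨
    ∑ xs (λ x → 𝟙 (x ≟ a)) * f a   ≡⟨ cong (_* f a) (enum a) ⟩
    1ℚ * f a                       ≡⟨ ℚP.*-identityˡ (f a) ⟩
    f a                            ∎
    where open ≡-Reasoning

  allFin-enumerates : ∀ n → Enumerates FinP._≟_ (allFin n)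
  allFin-enumerates (suc n) Fin.zero = begin
    ∑ (allFin (suc n)) (λ i → 𝟙 (i FinP.≟ Fin.zero))
      ≡⟨ ∑-allFin-suc n (λ i → 𝟙 (i FinP.≟ Fin.zero)) ⟩
    1ℚ + ∑ (allFin n) (λ i → 𝟙 (Fin.suc i FinP.≟ Fin.zero))
      ≡⟨ cong (1ℚ +_) (∑-cong (allFin n) (λ i → 𝟙-no (Fin.suc i FinP.≟ Fin.zero) λ ())) ⟩
    1ℚ + ∑ (allFin n) (λ _ → 0ℚ)
      ≡⟨ cong (1ℚ +_) (∑-zero (allFin n)) ⟩
    1ℚ + 0ℚ ∎
    where open ≡-Reasoning
  allFin-enumerates (suc n) (Fin.suc a) = begin
    ∑ (allFin (suc n)) (λ i → 𝟙 (i FinP.≟ Fin.suc a))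
      ≡⟨ ∑-allFin-suc n (λ i → 𝟙 (i FinP.≟ Fin.suc a)) ⟩
    0ℚ + ∑ (allFin n) (λ i → 𝟙 (Fin.suc i FinP.≟ Fin.suc a))
      ≡⟨ ℚP.+-identityˡ (∑ (allFin n) (λ i → 𝟙 (Fin.suc i FinP.≟ Fin.suc a))) ⟩
    ∑ (allFin n) (λ i → 𝟙 (Fin.suc i FinP.≟ Fin.suc a))
      ≡⟨ ∑-cong (allFin n) (λ i → 𝟙-⇔ (Fin.suc i FinP.≟ Fin.suc a) (i FinP.≟ a) (mk⇔ FinP.suc-injective (cong Fin.suc))) ⟩
    ∑ (allFin n) (λ i → 𝟙 (i FinP.≟ a))
      ≡⟨ allFin-enumerates n a ⟩
    1ℚ ∎
    where open ≡-Reasoning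

  maybe-enumerates : (_≟_ : DecidableEquality A) {xs : List A} → Enumerates _≟_ xs →
                     Enumerates (MaybeP.≡-dec _≟_) (nothing ∷ map just xs)
  maybe-enumerates _≟_ {xs} enum nothing = begin
    1ℚ + ∑ (map just xs) (λ m → 𝟙 (MaybeP.≡-dec _≟_ m nothing)) ≡⟨ cong (1ℚ +_) (∑-map just xs _) ⟩
    1ℚ + ∑ xs (λ _ → 0ℚ)                                         ≡⟨ cong (1ℚ +_) (∑-zero xs) ⟩
    1ℚ + 0ℚ                                                      ∎
    where open ≡-Reasoning
  maybe-enumerates _≟_ {xs} enum (just a) = begin
    0ℚ + ∑ (map just xs) (λ m → 𝟙 (MaybeP.≡-dec _≟_ m (just a))) ≡⟨ ℚP.+-identityˡ _ ⟩
    ∑ (map just xs) (λ m → 𝟙 (MaybeP.≡-dec _≟_ m (just a)))      ≡⟨ ∑-map just xs _ ⟩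
    ∑ xs (λ x → 𝟙 (x ≟ a))                                       ≡⟨ enum a ⟩
    1ℚ                                                           ∎
    where open ≡-Reasoning

  bools-enumerates : Enumerates BoolP._≟_ (true ∷ false ∷ [])
  bools-enumerates true  = refl
  bools-enumerates false = refl

  allVecs-enumerates : (_≟_ : DecidableEquality A) {xs : List A} → Enumerates _≟_ xs →
                       ∀ k → Enumerates (VecP.≡-dec {n = k} _≟_) (allVecs k xs)
  allVecs-enumerates _≟_ enum zero    [] = refl
  allVecs-enumerates _≟_ {xs} enum (suc k) (a ∷ w) = begin
    ∑ (allVecs (suc k) xs) (λ v → 𝟙 (VecP.≡-dec _≟_ v (a ∷ w)))
      ≡⟨ ∑-allVecs k xs _ ⟩
    ∑ xs (λ x → ∑ (allVecs k xs) (λ v → 𝟙 ((x ≟ a) ×-dec (VecP.≡-dec _≟_ v w))))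
      ≡⟨ ∑-cong xs (λ x → ∑-cong (allVecs k xs) (λ v → 𝟙-× (x ≟ a) (VecP.≡-dec _≟_ v w))) ⟩
    ∑ xs (λ x → ∑ (allVecs k xs) (λ v → 𝟙 (x ≟ a) * 𝟙 (VecP.≡-dec _≟_ v w)))
      ≡⟨ ∑-cong xs (λ x → *-∑ (allVecs k xs) (𝟙 (x ≟ a)) _) ⟨
    ∑ xs (λ x → 𝟙 (x ≟ a) * ∑ (allVecs k xs) (λ v → 𝟙 (VecP.≡-dec _≟_ v w)))
      ≡⟨ ∑-δ _≟_ xs enum a _ ⟩
    ∑ (allVecs k xs) (λ v → 𝟙 (VecP.≡-dec _≟_ v w))
      ≡⟨ allVecs-enumerates _≟_ enum k w ⟩
    1ℚ ∎
    where
    open ≡-Reasoning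

  cartesianProduct-enumerates : (_≟ᴬ_ : DecidableEquality A) (_≟ᴮ_ : DecidableEquality B)
    {xs : List A} {ys : List B} → Enumerates _≟ᴬ_ xs → Enumerates _≟ᴮ_ ys →
    Enumerates (×P.≡-dec _≟ᴬ_ _≟ᴮ_) (cartesianProduct xs ys)
  cartesianProduct-enumerates _≟ᴬ_ _≟ᴮ_ {xs} {ys} enumA enumB (a , b) = begin
    ∑ (cartesianProduct xs ys) (λ p → 𝟙 (×P.≡-dec _≟ᴬ_ _≟ᴮ_ p (a , b)))
      ≡⟨ ∑-cartesianProduct xs ys _ ⟩
    ∑ xs (λ x → ∑ ys (λ y → 𝟙 (×P.≡-dec _≟ᴬ_ _≟ᴮ_ (x , y) (a , b))))
      ≡⟨ ∑-cong xs (λ x → ∑-cong ys (λ y →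
           trans (𝟙-⇔ (×P.≡-dec _≟ᴬ_ _≟ᴮ_ (x , y) (a , b)) ((x ≟ᴬ a) ×-dec (y ≟ᴮ b)) (mk⇔ ×P.,-injective (uncurry (cong₂ _,_))))
                                                  (𝟙-× (x ≟ᴬ a) (y ≟ᴮ b)))) ⟩
    ∑ xs (λ x → ∑ ys (λ y → 𝟙 (x ≟ᴬ a) * 𝟙 (y ≟ᴮ b)))
      ≡⟨ ∑-cong xs (λ x → *-∑ ys (𝟙 (x ≟ᴬ a)) _) ⟨
    ∑ xs (λ x → 𝟙 (x ≟ᴬ a) * ∑ ys (λ y → 𝟙 (y ≟ᴮ b)))
      ≡⟨ ∑-δ _≟ᴬ_ xs enumA a _ ⟩
    ∑ ys (λ y → 𝟙 (y ≟ᴮ b))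
      ≡⟨ enumB b ⟩
    1ℚ ∎
    where
    open ≡-Reasoning

  ∑-reindex : {A D : Set} (_≟ᴬ_ : DecidableEquality A) (_≟ᴰ_ : DecidableEquality D)
    (as : List A) (ds : List D) → Enumerates _≟ᴬ_ as → Enumerates _≟ᴰ_ ds →
    {P : A → Set} (P? : Decidable P) {V : D → Set} (V? : Decidable V) (g : D → A) →
    (∀ {d} → V d → P (g d)) →
    (∀ {a} → P a → ∃ λ d₀ → ∀ d → (V d × g d ≡ a) ⇔ d ≡ d₀) →
    ∀ (f : A → ℚ) → ∑ as (λ a → 𝟙 (P? a) * f a) ≡ ∑ ds (λ d → 𝟙 (V? d) * f (g d))
  ∑-reindex {A} _≟ᴬ_ _≟ᴰ_ as ds enumA enumD {P} P? {V} V? g V⇒P fibre f = begin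
    ∑ as F                                                          ≡⟨ ∑-cong as (λ a → F≡F*fibre-size a) ⟩
    ∑ as (λ a → F a * ∑ ds (λ d → 𝟙 (V? d) * 𝟙 (g d ≟ᴬ a)))      ≡⟨ ∑-cong as (λ a → *-∑ ds (F a) _) ⟩
    ∑ as (λ a → ∑ ds (λ d → F a * (𝟙 (V? d) * 𝟙 (g d ≟ᴬ a))))    ≡⟨ ∑-swap as ds _ ⟩
    ∑ ds (λ d → ∑ as (λ a → F a * (𝟙 (V? d) * 𝟙 (g d ≟ᴬ a))))    ≡⟨ ∑-cong ds (λ d → ∑-cong as (λ a → rearrange d a)) ⟩
    ∑ ds (λ d → ∑ as (λ a → 𝟙 (V? d) * (𝟙 (a ≟ᴬ g d) * F a)))    ≡⟨ ∑-cong ds (λ d → *-∑ as (𝟙 (V? d)) _) ⟨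
    ∑ ds (λ d → 𝟙 (V? d) * ∑ as (λ a → 𝟙 (a ≟ᴬ g d) * F a))
      ≡⟨ ∑-cong ds (λ d → cong (𝟙 (V? d) *_) (∑-δ _≟ᴬ_ as enumA (g d) F)) ⟩
    ∑ ds (λ d → 𝟙 (V? d) * F (g d))                               ≡⟨ ∑-cong ds (λ d → 𝟙-guard (V? d) (λ v → drop-𝟙 (V⇒P v))) ⟩
    ∑ ds (λ d → 𝟙 (V? d) * f (g d))                               ∎
    where
    open ≡-Reasoning
    F : A → ℚ
    F a = 𝟙 (P? a) * f a
    drop-𝟙 : ∀ {a} → P a → F a ≡ f a
    drop-𝟙 {a} p = trans (cong (_* f a) (𝟙-yes (P? a) p)) (ℚP.*-identityˡ (f a))
    fibre-size : ∀ {a} → P a → ∑ ds (λ d → 𝟙 (V? d) * 𝟙 (g d ≟ᴬ a)) ≡ 1ℚ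
    fibre-size {a} p with d₀ , d∈fibre⇔d≡d₀ ← fibre p = begin
      ∑ ds (λ d → 𝟙 (V? d) * 𝟙 (g d ≟ᴬ a))   ≡⟨ ∑-cong ds (λ d → 𝟙-× (V? d) (g d ≟ᴬ a)) ⟨
      ∑ ds (λ d → 𝟙 (V? d ×-dec g d ≟ᴬ a))
        ≡⟨ ∑-cong ds (λ d → 𝟙-⇔ (V? d ×-dec g d ≟ᴬ a) (d ≟ᴰ d₀) (d∈fibre⇔d≡d₀ d)) ⟩
      ∑ ds (λ d → 𝟙 (d ≟ᴰ d₀))               ≡⟨ enumD d₀ ⟩
      1ℚ                                     ∎
    F≡F*fibre-size : ∀ a → F a ≡ F a * ∑ ds (λ d → 𝟙 (V? d) * 𝟙 (g d ≟ᴬ a))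
    F≡F*fibre-size a = trans (sym (ℚP.*-identityʳ (F a))) (trans (ℚP.*-assoc (𝟙 (P? a)) (f a) 1ℚ)
      (trans (𝟙-guard (P? a) (λ p → cong (f a *_) (sym (fibre-size p)))) (sym (ℚP.*-assoc (𝟙 (P? a)) (f a) _))))
    rearrange : ∀ d a → F a * (𝟙 (V? d) * 𝟙 (g d ≟ᴬ a)) ≡ 𝟙 (V? d) * (𝟙 (a ≟ᴬ g d) * F a)
    rearrange d a rewrite 𝟙-⇔ (g d ≟ᴬ a) (a ≟ᴬ g d) (mk⇔ sym sym) =
      solve 3 (λ x v e → x :* (v :* e) := v :* (e :* x)) refl (F a) (𝟙 (V? d)) (𝟙 (a ≟ᴬ g d))

  allSubsets : ∀ n → List (Subset n)
  allSubsets n = allVecs n (inside ∷ outside ∷ [])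

  allSubsets-enumerates : ∀ n → Enumerates (VecP.≡-dec BoolP._≟_) (allSubsets n)
  allSubsets-enumerates = allVecs-enumerates BoolP._≟_ bools-enumerates

  ∑-allSubsets : ∀ n (f : Subset (suc n) → ℚ) → ∑ (allSubsets (suc n)) f ≡
                 ∑ (allSubsets n) (λ T → f (inside ∷ T)) + ∑ (allSubsets n) (λ T → f (outside ∷ T))
  ∑-allSubsets n f = trans (∑-allVecs n (inside ∷ outside ∷ []) f)
    (cong (∑ (allSubsets n) (λ T → f (inside ∷ T)) +_) (ℚP.+-identityʳ (∑ (allSubsets n) (λ T → f (outside ∷ T)))))

  x∈p─q⇒x∉q : ∀ {n} {x : Fin n} {p q : Subset n} → x ∈ p ─ q → x ∉ q
  x∈p─q⇒x∉q {p = inside ∷ p} {outside ∷ q} here       ()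
  x∈p─q⇒x∉q {p = _ ∷ p}      {_ ∷ q}       (there x∈) (there x∈q) = x∈p─q⇒x∉q x∈ x∈q

  ∣p─q∣+∣q∣≡∣p∣ : ∀ {n} (p q : Subset n) → q ⊆ p → ∣ p ─ q ∣ ℕ.+ ∣ q ∣ ≡ ∣ p ∣
  ∣p─q∣+∣q∣≡∣p∣ []            []            _   = refl
  ∣p─q∣+∣q∣≡∣p∣ (inside ∷ p)  (inside ∷ q)  q⊆p = trans (ℕP.+-suc ∣ p ─ q ∣ ∣ q ∣) (cong suc (∣p─q∣+∣q∣≡∣p∣ p q (drop-∷-⊆ q⊆p)))
  ∣p─q∣+∣q∣≡∣p∣ (inside ∷ p)  (outside ∷ q) q⊆p = cong suc (∣p─q∣+∣q∣≡∣p∣ p q (drop-∷-⊆ q⊆p))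
  ∣p─q∣+∣q∣≡∣p∣ (outside ∷ p) (outside ∷ q) q⊆p = ∣p─q∣+∣q∣≡∣p∣ p q (drop-∷-⊆ q⊆p)
  ∣p─q∣+∣q∣≡∣p∣ (outside ∷ p) (inside ∷ q)  q⊆p with () ← q⊆p here

  x∈p⇒∣p-x∣≡∣p∣∸1 : ∀ {n} {x : Fin n} {p : Subset n} → x ∈ p → ∣ p ─ ⁅ x ⁆ ∣ ≡ ∣ p ∣ ∸ 1
  x∈p⇒∣p-x∣≡∣p∣∸1 {x = x} {p} x∈p = begin
    ∣ p ─ ⁅ x ⁆ ∣                       ≡⟨ ℕP.m+n∸n≡m ∣ p ─ ⁅ x ⁆ ∣ 1 ⟨
    ∣ p ─ ⁅ x ⁆ ∣ ℕ.+ 1 ∸ 1             ≡⟨ cong (λ k → ∣ p ─ ⁅ x ⁆ ∣ ℕ.+ k ∸ 1) (∣⁅x⁆∣≡1 x) ⟨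
    ∣ p ─ ⁅ x ⁆ ∣ ℕ.+ ∣ ⁅ x ⁆ ∣ ∸ 1     ≡⟨ cong (_∸ 1) (∣p─q∣+∣q∣≡∣p∣ p ⁅ x ⁆ ⁅x⁆⊆p) ⟩
    ∣ p ∣ ∸ 1                           ∎
    where
    open ≡-Reasoning
    ⁅x⁆⊆p : ⁅ x ⁆ ⊆ p
    ⁅x⁆⊆p y∈⁅x⁆ = subst (_∈ p) (sym (x∈⁅y⁆⇒x≡y x y∈⁅x⁆)) x∈p

  x∈p⇒∣p∣≥1 : ∀ {n} {x : Fin n} {p : Subset n} → x ∈ p → 1 ≤ ∣ p ∣
  x∈p⇒∣p∣≥1 x∈p = ℕP.≤-trans (s≤s z≤n) (x∈p⇒∣p-x∣<∣p∣ x∈p)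

  ∑-𝟙∈≡∣∣ : ∀ {n} (T : Subset n) → ∑ (allFin n) (λ r → 𝟙 (r ∈? T)) ≡ ℕ→ℚ ∣ T ∣
  ∑-𝟙∈≡∣∣ []            = refl
  ∑-𝟙∈≡∣∣ (inside ∷ T)  = trans (∑-allFin-suc _ (λ r → 𝟙 (r ∈? inside ∷ T))) (trans (cong (1ℚ +_) (∑-𝟙∈≡∣∣ T)) (sym (ℕ→ℚ-suc ∣ T ∣)))
  ∑-𝟙∈≡∣∣ (outside ∷ T) = trans (∑-allFin-suc _ (λ r → 𝟙 (r ∈? outside ∷ T))) (trans (ℚP.+-identityˡ _) (∑-𝟙∈≡∣∣ T))

  -- Vandermonde's identity over subsets

  ↑-vandermonde : ∀ {n} (S : Subset n) x y →
    ∑ (allSubsets n) (λ T → 𝟙 (T ⊆? S) * (x ↑ ∣ T ∣ * y ↑ ∣ S ─ T ∣)) ≡ (x + y) ↑ ∣ S ∣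
  ↑-vandermonde []                    x y = refl
  ↑-vandermonde {suc n} (inside ∷ S)  x y = begin
    ∑ (allSubsets (suc n)) (term (inside ∷ S) x y)
      ≡⟨ ∑-allSubsets n (term (inside ∷ S) x y) ⟩
    ∑ (allSubsets n) (λ T → 𝟙 (T ⊆? S) * (x * (x + 1ℚ) ↑ ∣ T ∣ * y ↑ ∣ S ─ T ∣))
      + ∑ (allSubsets n) (λ T → 𝟙 (T ⊆? S) * (x ↑ ∣ T ∣ * (y * (y + 1ℚ) ↑ ∣ S ─ T ∣)))
      ≡⟨ cong₂ _+_ (∑-cong (allSubsets n) (λ T → pullˡ x (𝟙 (T ⊆? S)) ((x + 1ℚ) ↑ ∣ T ∣) (y ↑ ∣ S ─ T ∣)))
                   (∑-cong (allSubsets n) (λ T → pullʳ y (𝟙 (T ⊆? S)) (x ↑ ∣ T ∣) ((y + 1ℚ) ↑ ∣ S ─ T ∣))) ⟩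
    ∑ (allSubsets n) (λ T → x * term S (x + 1ℚ) y T) + ∑ (allSubsets n) (λ T → y * term S x (y + 1ℚ) T)
      ≡⟨ cong₂ _+_ (*-∑ (allSubsets n) x (term S (x + 1ℚ) y)) (*-∑ (allSubsets n) y (term S x (y + 1ℚ))) ⟨
    x * ∑ (allSubsets n) (term S (x + 1ℚ) y) + y * ∑ (allSubsets n) (term S x (y + 1ℚ))
      ≡⟨ cong₂ (λ a b → x * a + y * b) (↑-vandermonde S (x + 1ℚ) y) (↑-vandermonde S x (y + 1ℚ)) ⟩
    x * (x + 1ℚ + y) ↑ ∣ S ∣ + y * (x + (y + 1ℚ)) ↑ ∣ S ∣
      ≡⟨ ↑-pascal x y ∣ S ∣ ⟩
    (x + y) ↑ suc ∣ S ∣ ∎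
    where
    open ≡-Reasoning
    term : ∀ {n} → Subset n → ℚ → ℚ → Subset n → ℚ
    term S x y T = 𝟙 (T ⊆? S) * (x ↑ ∣ T ∣ * y ↑ ∣ S ─ T ∣)
    pullˡ : ∀ a i u v → i * (a * u * v) ≡ a * (i * (u * v))
    pullˡ = solve 4 (λ a i u v → i :* (a :* u :* v) := a :* (i :* (u :* v))) refl
    pullʳ : ∀ a i u v → i * (u * (a * v)) ≡ a * (i * (u * v))
    pullʳ = solve 4 (λ a i u v → i :* (u :* (a :* v)) := a :* (i :* (u :* v))) refl
  ↑-vandermonde {suc n} (outside ∷ S) x y = begin
    ∑ (allSubsets (suc n)) (term (outside ∷ S))
      ≡⟨ ∑-allSubsets n (term (outside ∷ S)) ⟩
    ∑ (allSubsets n) (λ T → 0ℚ * rest T) + ∑ (allSubsets n) (term S)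
      ≡⟨ cong (_+ ∑ (allSubsets n) (term S)) (trans (∑-cong (allSubsets n) (λ T → ℚP.*-zeroˡ (rest T))) (∑-zero (allSubsets n))) ⟩
    0ℚ + ∑ (allSubsets n) (term S)
      ≡⟨ ℚP.+-identityˡ _ ⟩
    ∑ (allSubsets n) (term S)
      ≡⟨ ↑-vandermonde S x y ⟩
    (x + y) ↑ ∣ S ∣ ∎
    where
    open ≡-Reasoning
    term : ∀ {n} → Subset n → Subset n → ℚ
    term S T = 𝟙 (T ⊆? S) * (x ↑ ∣ T ∣ * y ↑ ∣ S ─ T ∣)
    rest : Subset n → ℚ
    rest T = x ↑ suc ∣ T ∣ * y ↑ ∣ S ─ T ∣

  ↑-pred : ∀ x c → 1 ≤ c → x ↑ c ≡ x * (x + 1ℚ) ↑ (c ∸ 1)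
  ↑-pred x (suc c) _ = refl

  ↑-vandermonde-pointed : ∀ {n} {s : Fin n} {S : Subset n} → s ∈ S → ∀ x y →
    ∑ (allSubsets n) (λ T → 𝟙 (s ∈? T) * (𝟙 (T ⊆? S) * (x ↑ (∣ T ∣ ∸ 1) * y ↑ ∣ S ─ T ∣))) ≡ (x + y) ↑ (∣ S ∣ ∸ 1)
  ↑-vandermonde-pointed {suc n} {S = inside ∷ S} here x y = begin
    ∑ (allSubsets (suc n)) (term Fin.zero (inside ∷ S) x y)
      ≡⟨ ∑-allSubsets n (term Fin.zero (inside ∷ S) x y) ⟩
    ∑ (allSubsets n) (λ T → 1ℚ * vandermonde T) + ∑ (allSubsets n) (λ T → 0ℚ * rest T)
      ≡⟨ cong₂ _+_ (∑-cong (allSubsets n) (λ T → ℚP.*-identityˡ (vandermonde T)))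
                   (trans (∑-cong (allSubsets n) (λ T → ℚP.*-zeroˡ (rest T))) (∑-zero (allSubsets n))) ⟩
    ∑ (allSubsets n) vandermonde + 0ℚ
      ≡⟨ ℚP.+-identityʳ _ ⟩
    ∑ (allSubsets n) vandermonde
      ≡⟨ ↑-vandermonde S x y ⟩
    (x + y) ↑ ∣ S ∣ ∎
    where
    open ≡-Reasoning
    vandermonde : Subset n → ℚ
    vandermonde T = 𝟙 (T ⊆? S) * (x ↑ ∣ T ∣ * y ↑ ∣ S ─ T ∣)
    rest : Subset n → ℚ
    rest T = 𝟙 (T ⊆? S) * (x ↑ (∣ T ∣ ∸ 1) * y ↑ suc ∣ S ─ T ∣)
    term : ∀ {n} → Fin n → Subset n → ℚ → ℚ → Subset n → ℚ
    term s S x y T = 𝟙 (s ∈? T) * (𝟙 (T ⊆? S) * (x ↑ (∣ T ∣ ∸ 1) * y ↑ ∣ S ─ T ∣))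
  ↑-vandermonde-pointed {suc n} {S = inside ∷ S} (there {i = s} s∈S) x y = begin
    ∑ (allSubsets (suc n)) (term (Fin.suc s) (inside ∷ S) x y)
      ≡⟨ ∑-allSubsets n (term (Fin.suc s) (inside ∷ S) x y) ⟩
    ∑ (allSubsets n) (λ T → 𝟙 (s ∈? T) * (𝟙 (T ⊆? S) * (x ↑ ∣ T ∣ * y ↑ ∣ S ─ T ∣)))
      + ∑ (allSubsets n) (λ T → 𝟙 (s ∈? T) * (𝟙 (T ⊆? S) * (x ↑ (∣ T ∣ ∸ 1) * (y * (y + 1ℚ) ↑ ∣ S ─ T ∣))))
      ≡⟨ cong₂ _+_ (∑-cong (allSubsets n) pull-x) (∑-cong (allSubsets n) pull-y) ⟩
    ∑ (allSubsets n) (λ T → x * term s S (x + 1ℚ) y T) + ∑ (allSubsets n) (λ T → y * term s S x (y + 1ℚ) T)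
      ≡⟨ cong₂ _+_ (*-∑ (allSubsets n) x (term s S (x + 1ℚ) y)) (*-∑ (allSubsets n) y (term s S x (y + 1ℚ))) ⟨
    x * ∑ (allSubsets n) (term s S (x + 1ℚ) y) + y * ∑ (allSubsets n) (term s S x (y + 1ℚ))
      ≡⟨ cong₂ (λ a b → x * a + y * b) (↑-vandermonde-pointed s∈S (x + 1ℚ) y) (↑-vandermonde-pointed s∈S x (y + 1ℚ)) ⟩
    x * (x + 1ℚ + y) ↑ (∣ S ∣ ∸ 1) + y * (x + (y + 1ℚ)) ↑ (∣ S ∣ ∸ 1)
      ≡⟨ ↑-pascal x y (∣ S ∣ ∸ 1) ⟩
    (x + y) ↑ suc (∣ S ∣ ∸ 1)
      ≡⟨ cong ((x + y) ↑_) (trans (ℕP.+-comm 1 (∣ S ∣ ∸ 1)) (ℕP.m∸n+n≡m (x∈p⇒∣p∣≥1 s∈S))) ⟩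
    (x + y) ↑ ∣ S ∣ ∎
    where
    open ≡-Reasoning
    term : ∀ {n} → Fin n → Subset n → ℚ → ℚ → Subset n → ℚ
    term s S x y T = 𝟙 (s ∈? T) * (𝟙 (T ⊆? S) * (x ↑ (∣ T ∣ ∸ 1) * y ↑ ∣ S ─ T ∣))
    pull-x : ∀ T → 𝟙 (s ∈? T) * (𝟙 (T ⊆? S) * (x ↑ ∣ T ∣ * y ↑ ∣ S ─ T ∣)) ≡ x * term s S (x + 1ℚ) y T
    pull-x T = trans (𝟙-guard (s ∈? T) (λ s∈T → cong (λ t → 𝟙 (T ⊆? S) * (t * y ↑ ∣ S ─ T ∣)) (↑-pred x ∣ T ∣ (x∈p⇒∣p∣≥1 s∈T))))
      (solve 5 (λ a i j u v → i :* (j :* ((a :* u) :* v)) := a :* (i :* (j :* (u :* v))))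
             refl x (𝟙 (s ∈? T)) (𝟙 (T ⊆? S)) ((x + 1ℚ) ↑ (∣ T ∣ ∸ 1)) (y ↑ ∣ S ─ T ∣))
    pull-y : ∀ T → 𝟙 (s ∈? T) * (𝟙 (T ⊆? S) * (x ↑ (∣ T ∣ ∸ 1) * (y * (y + 1ℚ) ↑ ∣ S ─ T ∣))) ≡ y * term s S x (y + 1ℚ) T
    pull-y T = solve 5 (λ a i j u v → i :* (j :* (u :* (a :* v))) := a :* (i :* (j :* (u :* v))))
                     refl y (𝟙 (s ∈? T)) (𝟙 (T ⊆? S)) (x ↑ (∣ T ∣ ∸ 1)) ((y + 1ℚ) ↑ ∣ S ─ T ∣)
  ↑-vandermonde-pointed {suc n} {S = outside ∷ S} (there {i = s} s∈S) x y = begin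
    ∑ (allSubsets (suc n)) (term (Fin.suc s) (outside ∷ S))
      ≡⟨ ∑-allSubsets n (term (Fin.suc s) (outside ∷ S)) ⟩
    ∑ (allSubsets n) (λ T → 𝟙 (s ∈? T) * (0ℚ * rest T)) + ∑ (allSubsets n) (term s S)
      ≡⟨ cong (_+ ∑ (allSubsets n) (term s S)) (trans (∑-cong (allSubsets n) vanish) (∑-zero (allSubsets n))) ⟩
    0ℚ + ∑ (allSubsets n) (term s S)
      ≡⟨ ℚP.+-identityˡ _ ⟩
    ∑ (allSubsets n) (term s S)
      ≡⟨ ↑-vandermonde-pointed s∈S x y ⟩
    (x + y) ↑ (∣ S ∣ ∸ 1) ∎
    where
    open ≡-Reasoning
    term : ∀ {n} → Fin n → Subset n → Subset n → ℚ
    term s S T = 𝟙 (s ∈? T) * (𝟙 (T ⊆? S) * (x ↑ (∣ T ∣ ∸ 1) * y ↑ ∣ S ─ T ∣))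
    rest : Subset n → ℚ
    rest T = x ↑ ∣ T ∣ * y ↑ ∣ S ─ T ∣
    vanish : ∀ T → 𝟙 (s ∈? T) * (0ℚ * rest T) ≡ 0ℚ
    vanish T = trans (cong (𝟙 (s ∈? T) *_) (ℚP.*-zeroˡ (rest T))) (ℚP.*-zeroʳ (𝟙 (s ∈? T)))

  length-filter-tabulate : ∀ {P : A → Set} (P? : Decidable P) {n} (f : Fin n → A) (T : Subset n) →
                           (∀ i → P (f i) ⇔ i ∈ T) → List.length (filter P? (tabulate f)) ≡ ∣ T ∣
  length-filter-tabulate P? f []      _    = refl
  length-filter-tabulate {P = P} P? f (b ∷ T) P⇔∈ with P? (f Fin.zero) | b
  ... | yes p  | inside  = cong suc (length-filter-tabulate P? (f ∘ Fin.suc) T P⇔∈T)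
    where
    P⇔∈T : ∀ i → P (f (Fin.suc i)) ⇔ i ∈ T
    P⇔∈T i = mk⇔ (drop-there ∘ Equivalence.to (P⇔∈ (Fin.suc i))) (Equivalence.from (P⇔∈ (Fin.suc i)) ∘ there)
  ... | yes p  | outside with () ← Equivalence.to (P⇔∈ Fin.zero) p
  ... | no ¬p  | inside  = ⊥-elim (¬p (Equivalence.from (P⇔∈ Fin.zero) here))
  ... | no ¬p  | outside = length-filter-tabulate P? (f ∘ Fin.suc) T P⇔∈T
    where
    P⇔∈T : ∀ i → P (f (Fin.suc i)) ⇔ i ∈ T
    P⇔∈T i = mk⇔ (drop-there ∘ Equivalence.to (P⇔∈ (Fin.suc i))) (Equivalence.from (P⇔∈ (Fin.suc i)) ∘ there)

  does≡true⇔ : (P? : Dec P) → does P? ≡ true ⇔ P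
  does≡true⇔ (yes p) = mk⇔ (λ _ → p) (λ _ → refl)
  does≡true⇔ (no ¬p) = mk⇔ (λ ()) (λ p → contradiction p ¬p)

  ∈-tabulate⇔ : ∀ {n} (f : Fin n → Bool) v → v ∈ Vec.tabulate f ⇔ f v ≡ true
  ∈-tabulate⇔ f v = mk⇔ (λ v∈ → trans (sym (VecP.lookup∘tabulate f v)) (VecP.[]=⇒lookup v∈))
                        (λ fv → VecP.lookup⇒[]= v (Vec.tabulate f) (trans (VecP.lookup∘tabulate f v) fv))

  lookup-ext : ∀ {n} (xs ys : Vec A n) → (∀ i → lookup xs i ≡ lookup ys i) → xs ≡ ys
  lookup-ext xs ys eq = trans (sym (VecP.tabulate∘lookup xs)) (trans (VecP.tabulate-cong eq) (VecP.tabulate∘lookup ys))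

  -- Forests as parent functions

  module Forests (N : ℕ) where

    Parent : Set
    Parent = ParentFn N

    infix 4 _⊢_⇝_

    data _⊢_⇝_ (p : Parent) : Fin N → Fin N → Set where
      here  : ∀ {v} → p ⊢ v ⇝ v
      there : ∀ {v w u} → lookup p v ≡ just w → p ⊢ w ⇝ u → p ⊢ v ⇝ u

    data Rooted (p : Parent) : Fin N → Set where
      root : ∀ {v} → lookup p v ≡ nothing → Rooted p v
      up   : ∀ {v w} → lookup p v ≡ just w → Rooted p w → Rooted p v

    module _ {p : Parent} where

      iter-nothing : ∀ k → iter p k nothing ≡ nothing
      iter-nothing zero    = refl
      iter-nothing (suc k) = iter-nothing k

      iter-+ : ∀ a b m → iter p (a ℕ.+ b) m ≡ iter p b (iter p a m)
      iter-+ zero    b m = refl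
      iter-+ (suc a) b m = iter-+ a b (step p m)

      iter-step : ∀ {v w} k → lookup p v ≡ just w → iter p (suc k) (just v) ≡ iter p k (just w)
      iter-step k pv≡w rewrite pv≡w = refl

      ⇝⇒iter : ∀ {v u} → p ⊢ v ⇝ u → ∃ λ k → iter p k (just v) ≡ just u
      ⇝⇒iter here = 0 , refl
      ⇝⇒iter (there pv≡w w⇝u) with k , eq ← ⇝⇒iter w⇝u = suc k , trans (iter-step k pv≡w) eq

      iter⇒⇝ : ∀ k {v u} → iter p k (just v) ≡ just u → p ⊢ v ⇝ u
      iter⇒⇝ zero    refl = here
      iter⇒⇝ (suc k) {v} eq with lookup p v in pv
      ... | just w  = there pv (iter⇒⇝ k eq)
      ... | nothing with () ← trans (sym (iter-nothing k)) eq

      Rooted⇒iter : ∀ {v} → Rooted p v → ∃ λ k → iter p k (just v) ≡ nothing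
      Rooted⇒iter (root pv≡nothing) = 1 , pv≡nothing
      Rooted⇒iter (up pv≡w rooted) with k , eq ← Rooted⇒iter rooted = suc k , trans (iter-step k pv≡w) eq

      iter⇒Rooted : ∀ k {v} → iter p k (just v) ≡ nothing → Rooted p v
      iter⇒Rooted (suc k) {v} eq with lookup p v in pv
      ... | nothing = root pv
      ... | just w  = up pv (iter⇒Rooted k eq)

      iter-stopped : ∀ {i n m} → i ≤ n → iter p i m ≡ nothing → iter p n m ≡ nothing
      iter-stopped {i} {n} {m} i≤n stopᵢ = begin
        iter p n m                      ≡⟨ cong (λ k → iter p k m) (ℕP.m+[n∸m]≡n i≤n) ⟨
        iter p (i ℕ.+ (n ∸ i)) m        ≡⟨ iter-+ i (n ∸ i) m ⟩
        iter p (n ∸ i) (iter p i m)     ≡⟨ cong (iter p (n ∸ i)) stopᵢ ⟩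
        iter p (n ∸ i) nothing          ≡⟨ iter-nothing (n ∸ i) ⟩
        nothing                         ∎
        where open ≡-Reasoning

      iter-defined-before : ∀ {i n m w} → i ≤ n → iter p n m ≡ just w → ∃ λ u → iter p i m ≡ just u
      iter-defined-before {i} {n} {m} i≤n eq with iter p i m in eqᵢ
      ... | just u  = u , refl
      ... | nothing with () ← trans (sym (iter-stopped i≤n eqᵢ)) eq

      -- The orbit of v under a partial map on N points repeats a value among its
      -- first N + 1 terms unless it has stopped, so every value is reached within N steps.
      iter-within : ∀ k {v m} → iter p k (just v) ≡ m → ∃ λ k′ → k′ ≤ N × iter p k′ (just v) ≡ m
      iter-within k = go k (<-wellFounded k)
        where
        go : ∀ k → Acc _<_ k → ∀ {v m} → iter p k (just v) ≡ m → ∃ λ k′ → k′ ≤ N × iter p k′ (just v) ≡ m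
        go k (acc shorter) {v} {m} eq with k ℕP.≤? N
        ... | yes k≤N = k , k≤N , eq
        ... | no  k≰N with iter p N (just v) in eqN
        ...   | nothing = N , ℕP.≤-refl , trans eqN (trans (sym (iter-stopped (ℕP.<⇒≤ (ℕP.≰⇒> k≰N)) eqN)) eq)
        ...   | just w  = go k′ (shorter k′<k) eq′
          where
          N<k : N < k
          N<k = ℕP.≰⇒> k≰N
          value : (i : Fin (suc N)) → ∃ λ u → iter p (Fin.toℕ i) (just v) ≡ just u
          value i = iter-defined-before (FinP.toℕ≤pred[n] i) eqN
          repeat : ∃₂ λ i j → i Fin.< j × proj₁ (value i) ≡ proj₁ (value j)
          repeat = FinP.pigeonhole (ℕP.n<1+n N) (λ i → proj₁ (value i))
          i j : Fin (suc N)
          i = proj₁ repeat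
          j = proj₁ (proj₂ repeat)
          i<j : Fin.toℕ i < Fin.toℕ j
          i<j = proj₁ (proj₂ (proj₂ repeat))
          iterᵢ≡iterⱼ : iter p (Fin.toℕ i) (just v) ≡ iter p (Fin.toℕ j) (just v)
          iterᵢ≡iterⱼ = trans (proj₂ (value i)) (trans (cong just (proj₂ (proj₂ (proj₂ repeat)))) (sym (proj₂ (value j))))
          j≤k : Fin.toℕ j ≤ k
          j≤k = ℕP.≤-trans (FinP.toℕ≤pred[n] j) (ℕP.<⇒≤ N<k)
          k′ : ℕ
          k′ = Fin.toℕ i ℕ.+ (k ∸ Fin.toℕ j)
          k′<k : k′ < k
          k′<k = ℕP.<-≤-trans (ℕP.+-monoˡ-< (k ∸ Fin.toℕ j) i<j) (ℕP.≤-reflexive (ℕP.m+[n∸m]≡n j≤k))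
          eq′ : iter p k′ (just v) ≡ m
          eq′ = begin
            iter p k′ (just v)                                             ≡⟨ iter-+ (Fin.toℕ i) (k ∸ Fin.toℕ j) (just v) ⟩
            iter p (k ∸ Fin.toℕ j) (iter p (Fin.toℕ i) (just v))           ≡⟨ cong (iter p (k ∸ Fin.toℕ j)) iterᵢ≡iterⱼ ⟩
            iter p (k ∸ Fin.toℕ j) (iter p (Fin.toℕ j) (just v))           ≡⟨ iter-+ (Fin.toℕ j) (k ∸ Fin.toℕ j) (just v) ⟨
            iter p (Fin.toℕ j ℕ.+ (k ∸ Fin.toℕ j)) (just v)                ≡⟨ cong (λ l → iter p l (just v)) (ℕP.m+[n∸m]≡n j≤k) ⟩
            iter p k (just v)                                              ≡⟨ eq ⟩
            m                                                              ∎
            where open ≡-Reasoning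

      Rooted⇒iterN : ∀ {v} → Rooted p v → iter p N (just v) ≡ nothing
      Rooted⇒iterN rooted with k , eq ← Rooted⇒iter rooted with k′ , k′≤N , eq′ ← iter-within k eq = iter-stopped k′≤N eq′

    isForest⇔Rooted : ∀ p → isForest p ≡ true ⇔ (∀ v → Rooted p v)
    isForest⇔Rooted p = mk⇔
      (λ isF v → iter⇒Rooted N (All.lookup (toWitness (Equivalence.from BoolP.T-≡ isF)) (∈P.∈-allFin v)))
      (λ rooted → Equivalence.to BoolP.T-≡ (fromWitness (All.tabulate (λ {v} _ → Rooted⇒iterN (rooted v)))))

    isDesc⇔⇝ : ∀ p u v → isDesc p u v ⇔ p ⊢ v ⇝ u
    isDesc⇔⇝ p u v = mk⇔
      (λ desc → iter⇒⇝ (proj₁ (Any.satisfied desc)) (proj₂ (Any.satisfied desc)))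
      (λ v⇝u → let k , eq = ⇝⇒iter v⇝u ; k′ , k′≤N , eq′ = iter-within k eq in lose (∈P.∈-upTo⁺ (s≤s k′≤N)) eq′)

    _⊢_⇝?_ : ∀ p v u → Dec (p ⊢ v ⇝ u)
    p ⊢ v ⇝? u = map′ (Equivalence.to (isDesc⇔⇝ p u v)) (Equivalence.from (isDesc⇔⇝ p u v))
                      (Any.any? (λ k → iter p k (just v) ≟M just u) (List.upTo (suc N)))

    hook≡∣∣ : ∀ p u (T : Subset N) → (∀ v → v ∈ T ⇔ p ⊢ v ⇝ u) → hook p u ≡ ∣ T ∣
    hook≡∣∣ p u T ∈⇔⇝ = length-filter-tabulate _ id T (λ v → ⇔.trans (isDesc⇔⇝ p u v) (⇔.sym (∈⇔⇝ v)))

    hook-cong : ∀ {p q u} → (∀ v → p ⊢ v ⇝ u ⇔ q ⊢ v ⇝ u) → hook p u ≡ hook q u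
    hook-cong {p} {q} {u} ⇝⇔⇝ = cong List.length (ListP.filter-≐ _ _ (to , from) (allFin N))
      where
      to : ∀ {v} → isDesc p u v → isDesc q u v
      to {v} = Equivalence.from (isDesc⇔⇝ q u v) ∘ Equivalence.to (⇝⇔⇝ v) ∘ Equivalence.to (isDesc⇔⇝ p u v)
      from : ∀ {v} → isDesc q u v → isDesc p u v
      from {v} = Equivalence.from (isDesc⇔⇝ p u v) ∘ Equivalence.from (⇝⇔⇝ v) ∘ Equivalence.to (isDesc⇔⇝ q u v)

    module _ {p : Parent} where

      ⇝-from-root : ∀ {v u} → lookup p v ≡ nothing → p ⊢ v ⇝ u → v ≡ u
      ⇝-from-root pv≡nothing here             = refl
      ⇝-from-root pv≡nothing (there pv≡w _) with () ← trans (sym pv≡nothing) pv≡w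

      ⇝-step : ∀ {v w u} → p ⊢ v ⇝ u → v ≢ u → lookup p v ≡ just w → p ⊢ w ⇝ u
      ⇝-step here            v≢u _     = contradiction refl v≢u
      ⇝-step (there pv≡w′ w′⇝u) _ pv≡w with refl ← trans (sym pv≡w) pv≡w′ = w′⇝u

      ⇝-root-unique : ∀ {v u u′} → p ⊢ v ⇝ u → p ⊢ v ⇝ u′ → lookup p u ≡ nothing → lookup p u′ ≡ nothing → u ≡ u′
      ⇝-root-unique here               v⇝u′ pu≡nothing _ = ⇝-from-root pu≡nothing v⇝u′
      ⇝-root-unique (there pv≡w w⇝u) here _ pu′≡nothing with () ← trans (sym pu′≡nothing) pv≡w
      ⇝-root-unique (there pv≡w w⇝u) (there pv≡w′ w′⇝u′) pu≡nothing pu′≡nothing with refl ← trans (sym pv≡w) pv≡w′ =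
        ⇝-root-unique w⇝u w′⇝u′ pu≡nothing pu′≡nothing

      ⇝-rooted : ∀ {v u} → p ⊢ v ⇝ u → lookup p u ≡ nothing → Rooted p v
      ⇝-rooted here             pu≡nothing = root pu≡nothing
      ⇝-rooted (there pv≡w w⇝u) pu≡nothing = up pv≡w (⇝-rooted w⇝u pu≡nothing)

      root-of : ∀ {v} → Rooted p v → ∃ λ r → p ⊢ v ⇝ r × lookup p r ≡ nothing
      root-of (root pv≡nothing) = _ , here , pv≡nothing
      root-of (up pv≡w rooted) with r , w⇝r , pr≡nothing ← root-of rooted = r , there pv≡w w⇝r , pr≡nothing

    pruned-rooted : ∀ {p q} → (∀ v {w} → lookup q v ≡ just w → lookup p v ≡ just w) → ∀ {v} → Rooted p v → Rooted q v
    pruned-rooted {q = q} q⊆p {v} rooted with lookup q v in qv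
    ... | nothing = root qv
    ... | just w with rooted
    ...   | root pv≡nothing with () ← trans (sym pv≡nothing) (q⊆p v qv)
    ...   | up pv≡w′ rooted′ with refl ← trans (sym (q⊆p v qv)) pv≡w′ = up qv (pruned-rooted q⊆p rooted′)

    EdgeWithin : Subset N → Fin N → Maybe (Fin N) → Set
    EdgeWithin S v nothing  = ⊤
    EdgeWithin S v (just u) = v ∈ S × u ∈ S

    edgeWithin? : ∀ S v m → Dec (EdgeWithin S v m)
    edgeWithin? S v nothing  = yes tt
    edgeWithin? S v (just u) = v ∈? S ×-dec u ∈? S

    -- A forest on S is encoded on all of Fin N, with the vertices outside S as isolated roots.
    ForestOn : Subset N → Parent → Set
    ForestOn S p = (∀ v → EdgeWithin S v (lookup p v)) × (∀ v → Rooted p v)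

    forestOn? : ∀ S p → Dec (ForestOn S p)
    forestOn? S p = FinP.all? (λ v → edgeWithin? S v (lookup p v))
             ×-dec Dec.map (isForest⇔Rooted p) (isForest p BoolP.≟ true)

    module _ {S : Subset N} {p : Parent} (forest : ForestOn S p) where

      edge-within : ∀ {v u} → lookup p v ≡ just u → v ∈ S × u ∈ S
      edge-within {v} pv≡u = subst (EdgeWithin S v) pv≡u (proj₁ forest v)

      outside-root : ∀ {v} → v ∉ S → lookup p v ≡ nothing
      outside-root {v} v∉S with lookup p v in pv
      ... | nothing = refl
      ... | just u  = contradiction (proj₁ (edge-within pv)) v∉S

      ⇝-within : ∀ {v u} → v ∈ S → p ⊢ v ⇝ u → u ∈ S
      ⇝-within v∈S here             = v∈S
      ⇝-within v∈S (there pv≡w w⇝u) = ⇝-within (proj₂ (edge-within pv≡w)) w⇝u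

    ∈-delete : ∀ {v r} {T : Subset N} → v ∈ T ─ ⁅ r ⁆ → v ∈ T × v ≢ r
    ∈-delete {T = T} v∈ = p─q⊆p T _ v∈ , x∉⁅y⁆⇒x≢y (x∈p─q⇒x∉q v∈)

    graftAt : Subset N → Fin N → Parent → Parent → Fin N → Maybe (Fin N)
    graftAt T r q₁ q₂ v with v FinP.≟ r | v ∈? T
    ... | yes _ | _     = nothing
    ... | no _  | yes _ = just (fromMaybe r (lookup q₁ v))
    ... | no _  | no _  = lookup q₂ v

    -- The roots of q₁ become children of the new root r.
    graft : Subset N → Fin N → Parent → Parent → Parent
    graft T r q₁ q₂ = Vec.tabulate (graftAt T r q₁ q₂)

    module _ {T : Subset N} {r : Fin N} {q₁ q₂ : Parent} where

      graft-root : lookup (graft T r q₁ q₂) r ≡ nothing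
      graft-root rewrite VecP.lookup∘tabulate (graftAt T r q₁ q₂) r with r FinP.≟ r
      ... | yes _   = refl
      ... | no r≢r  = contradiction refl r≢r

      graft-inside : ∀ {v} → v ≢ r → v ∈ T → lookup (graft T r q₁ q₂) v ≡ just (fromMaybe r (lookup q₁ v))
      graft-inside {v} v≢r v∈T rewrite VecP.lookup∘tabulate (graftAt T r q₁ q₂) v with v FinP.≟ r | v ∈? T
      ... | yes v≡r | _       = contradiction v≡r v≢r
      ... | no _    | yes _   = refl
      ... | no _    | no v∉T  = contradiction v∈T v∉T

      graft-outside : ∀ {v} → r ∈ T → v ∉ T → lookup (graft T r q₁ q₂) v ≡ lookup q₂ v
      graft-outside {v} r∈T v∉T rewrite VecP.lookup∘tabulate (graftAt T r q₁ q₂) v with v FinP.≟ r | v ∈? T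
      ... | yes refl | _      = contradiction r∈T v∉T
      ... | no _     | yes v∈T = contradiction v∈T v∉T
      ... | no _     | no _   = refl

    module Graft {S T : Subset N} {r : Fin N} {q₁ q₂ : Parent} (T⊆S : T ⊆ S) (r∈T : r ∈ T)
                 (forest₁ : ForestOn (T ─ ⁅ r ⁆) q₁) (forest₂ : ForestOn (S ─ T) q₂) where

      private
        b : Parent
        b = graft T r q₁ q₂

      parent-inside : ∀ {v w} → v ∈ T → lookup b v ≡ just w → w ∈ T
      parent-inside {v} v∈T bv≡w with v FinP.≟ r
      ... | yes refl with () ← trans (sym graft-root) bv≡w
      ... | no v≢r with lookup q₁ v in q₁v | trans (sym (graft-inside v≢r v∈T)) bv≡w
      ...   | nothing | refl = r∈T
      ...   | just u  | refl = proj₁ (∈-delete (proj₂ (edge-within forest₁ q₁v)))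

      parent-outside : ∀ {v w} → v ∉ T → lookup b v ≡ just w → w ∉ T
      parent-outside v∉T bv≡w = x∈p─q⇒x∉q (proj₂ (edge-within forest₂ (trans (sym (graft-outside r∈T v∉T)) bv≡w)))

      ⇝-inside : ∀ {v u} → v ∈ T → b ⊢ v ⇝ u → u ∈ T
      ⇝-inside v∈T here             = v∈T
      ⇝-inside v∈T (there bv≡w w⇝u) = ⇝-inside (parent-inside v∈T bv≡w) w⇝u

      ⇝-outside : ∀ {v u} → v ∉ T → b ⊢ v ⇝ u → u ∉ T
      ⇝-outside v∉T here             = v∉T
      ⇝-outside v∉T (there bv≡w w⇝u) = ⇝-outside (parent-outside v∉T bv≡w) w⇝u

      inside⇝r : ∀ {v} → v ∈ T → b ⊢ v ⇝ r
      inside⇝r {v} v∈T with v FinP.≟ r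
      ... | yes refl = here
      ... | no v≢r   = go (proj₂ forest₁ v) v∈T v≢r
        where
        go : ∀ {v} → Rooted q₁ v → v ∈ T → v ≢ r → b ⊢ v ⇝ r
        go {v} (root q₁v≡nothing) v∈T v≢r = there (trans (graft-inside v≢r v∈T) (cong (just ∘ fromMaybe r) q₁v≡nothing)) here
        go {v} (up {w = w} q₁v≡w rooted) v∈T v≢r with w∈T , w≢r ← ∈-delete (proj₂ (edge-within forest₁ q₁v≡w)) =
          there (trans (graft-inside v≢r v∈T) (cong (just ∘ fromMaybe r) q₁v≡w)) (go rooted w∈T w≢r)

      ⇝r⇔inside : ∀ v → b ⊢ v ⇝ r ⇔ v ∈ T
      ⇝r⇔inside v = mk⇔ (λ v⇝r → decidable-stable (v ∈? T) (λ v∉T → ⇝-outside v∉T v⇝r r∈T)) inside⇝r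

      ⇝⇔⇝₁ : ∀ {u} → u ∈ T → u ≢ r → ∀ v → b ⊢ v ⇝ u ⇔ q₁ ⊢ v ⇝ u
      ⇝⇔⇝₁ {u} u∈T u≢r v = mk⇔ to from
        where
        to : ∀ {v} → b ⊢ v ⇝ u → q₁ ⊢ v ⇝ u
        to here = here
        to {v} (there bv≡w w⇝u) with v FinP.≟ r
        ... | yes refl with () ← trans (sym graft-root) bv≡w
        ... | no v≢r with lookup q₁ v in q₁v
                        | trans (sym (graft-inside v≢r (decidable-stable (v ∈? T) (λ v∉T → ⇝-outside v∉T (there bv≡w w⇝u) u∈T)))) bv≡w
        ...   | nothing | refl = contradiction (sym (⇝-from-root graft-root w⇝u)) u≢r
        ...   | just _  | refl = there q₁v (to w⇝u)
        from : ∀ {v} → q₁ ⊢ v ⇝ u → b ⊢ v ⇝ u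
        from here = here
        from (there q₁v≡w w⇝u) with v∈T , v≢r ← ∈-delete (proj₁ (edge-within forest₁ q₁v≡w)) =
          there (trans (graft-inside v≢r v∈T) (cong (just ∘ fromMaybe r) q₁v≡w)) (from w⇝u)

      ⇝⇔⇝₂ : ∀ {u} → u ∉ T → ∀ v → b ⊢ v ⇝ u ⇔ q₂ ⊢ v ⇝ u
      ⇝⇔⇝₂ {u} u∉T v = mk⇔ to from
        where
        to : ∀ {v} → b ⊢ v ⇝ u → q₂ ⊢ v ⇝ u
        to here = here
        to {v} (there bv≡w w⇝u) =
          there (trans (sym (graft-outside r∈T (λ v∈T → u∉T (⇝-inside v∈T (there bv≡w w⇝u))))) bv≡w) (to w⇝u)
        from : ∀ {v} → q₂ ⊢ v ⇝ u → b ⊢ v ⇝ u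
        from here = here
        from (there q₂v≡w w⇝u) = there (trans (graft-outside r∈T (x∈p─q⇒x∉q (proj₁ (edge-within forest₂ q₂v≡w)))) q₂v≡w) (from w⇝u)

      rooted : ∀ v → Rooted b v
      rooted v with v ∈? T
      ... | yes v∈T = ⇝-rooted (inside⇝r v∈T) graft-root
      ... | no  v∉T = go (proj₂ forest₂ v) v∉T
        where
        go : ∀ {v} → Rooted q₂ v → v ∉ T → Rooted b v
        go (root q₂v≡nothing) v∉T = root (trans (graft-outside r∈T v∉T) q₂v≡nothing)
        go (up q₂v≡w rooted) v∉T =
          up (trans (graft-outside r∈T v∉T) q₂v≡w) (go rooted (x∈p─q⇒x∉q (proj₂ (edge-within forest₂ q₂v≡w))))

      edges-within : ∀ v → EdgeWithin S v (lookup b v)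
      edges-within v with lookup b v in bv
      ... | nothing = tt
      ... | just w with v ∈? T
      ...   | yes v∈T = T⊆S v∈T , T⊆S (parent-inside v∈T bv)
      ...   | no  v∉T = let v∈ , w∈ = edge-within forest₂ (trans (sym (graft-outside r∈T v∉T)) bv)
                        in p─q⊆p S T v∈ , p─q⊆p S T w∈

      forest : ForestOn S b
      forest = edges-within , rooted

      hook-root : hook b r ≡ ∣ T ∣
      hook-root = hook≡∣∣ b r T (λ v → ⇔.sym (⇝r⇔inside v))

      hook-inside : ∀ {u} → u ∈ T → u ≢ r → hook b u ≡ hook q₁ u
      hook-inside u∈T u≢r = hook-cong (⇝⇔⇝₁ u∈T u≢r)

      hook-outside : ∀ {u} → u ∉ T → hook b u ≡ hook q₂ u
      hook-outside u∉T = hook-cong (⇝⇔⇝₂ u∉T)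

    Decomposition : Set
    Decomposition = Subset N × Fin N × Parent × Parent

    -- The tree T of s with its root r, the forest on T ∖ {r} below r, and the forest on S ∖ T.
    Valid : Subset N → Fin N → Decomposition → Set
    Valid S s (T , r , q₁ , q₂) = s ∈ T × T ⊆ S × r ∈ T × ForestOn (T ─ ⁅ r ⁆) q₁ × ForestOn (S ─ T) q₂

    valid? : ∀ S s d → Dec (Valid S s d)
    valid? S s (T , r , q₁ , q₂) = s ∈? T ×-dec T ⊆? S ×-dec r ∈? T ×-dec forestOn? (T ─ ⁅ r ⁆) q₁ ×-dec forestOn? (S ─ T) q₂

    graftᵈ : Decomposition → Parent
    graftᵈ (T , r , q₁ , q₂) = graft T r q₁ q₂

    graft-forest : ∀ {S s} d → Valid S s d → ForestOn S (graftᵈ d)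
    graft-forest d (_ , T⊆S , r∈T , forest₁ , forest₂) = Graft.forest T⊆S r∈T forest₁ forest₂

    module Decompose {S : Subset N} {p : Parent} (forestₚ : ForestOn S p) {s : Fin N} (s∈S : s ∈ S) where

      private
        tree-root : ∃ λ r → p ⊢ s ⇝ r × lookup p r ≡ nothing
        tree-root = root-of (proj₂ forestₚ s)

      r₀ : Fin N
      r₀ = proj₁ tree-root

      s⇝r₀ : p ⊢ s ⇝ r₀
      s⇝r₀ = proj₁ (proj₂ tree-root)

      r₀-root : lookup p r₀ ≡ nothing
      r₀-root = proj₂ (proj₂ tree-root)

      T₀ : Subset N
      T₀ = Vec.tabulate (λ v → does (p ⊢ v ⇝? r₀))

      ∈T₀⇔ : ∀ v → v ∈ T₀ ⇔ p ⊢ v ⇝ r₀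
      ∈T₀⇔ v = ⇔.trans (∈-tabulate⇔ (λ v → does (p ⊢ v ⇝? r₀)) v) (does≡true⇔ (p ⊢ v ⇝? r₀))

      strip : Maybe (Fin N) → Maybe (Fin N)
      strip nothing  = nothing
      strip (just u) with u FinP.≟ r₀
      ... | yes _ = nothing
      ... | no  _ = just u

      inner : Fin N → Maybe (Fin N)
      inner v with v ∈? T₀
      ... | yes _ = strip (lookup p v)
      ... | no  _ = nothing

      outer : Fin N → Maybe (Fin N)
      outer v with v ∈? T₀
      ... | yes _ = nothing
      ... | no  _ = lookup p v

      q₁₀ q₂₀ : Parent
      q₁₀ = Vec.tabulate inner
      q₂₀ = Vec.tabulate outer

      d₀ : Decomposition
      d₀ = T₀ , r₀ , q₁₀ , q₂₀

      strip-just : ∀ {m u} → strip m ≡ just u → m ≡ just u × u ≢ r₀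
      strip-just {just w} eq with w FinP.≟ r₀ | eq
      ... | no w≢r₀ | refl = refl , w≢r₀

      strip-fromMaybe : ∀ m → (∀ {u} → m ≡ just u → u ≢ r₀) → strip (just (fromMaybe r₀ m)) ≡ m
      strip-fromMaybe nothing  _ with r₀ FinP.≟ r₀
      ... | yes _   = refl
      ... | no r₀≢r₀ = contradiction refl r₀≢r₀
      strip-fromMaybe (just u) m≢r₀ with u FinP.≟ r₀
      ... | yes u≡r₀ = contradiction u≡r₀ (m≢r₀ refl)
      ... | no  _    = refl

      fromMaybe-strip : ∀ w → just (fromMaybe r₀ (strip (just w))) ≡ just w
      fromMaybe-strip w with w FinP.≟ r₀
      ... | yes refl = refl
      ... | no  _    = refl

      q₁₀-inside : ∀ {v} → v ∈ T₀ → lookup q₁₀ v ≡ strip (lookup p v)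
      q₁₀-inside {v} v∈T₀ rewrite VecP.lookup∘tabulate inner v with v ∈? T₀
      ... | yes _    = refl
      ... | no v∉T₀  = contradiction v∈T₀ v∉T₀

      q₁₀-outside : ∀ {v} → v ∉ T₀ → lookup q₁₀ v ≡ nothing
      q₁₀-outside {v} v∉T₀ rewrite VecP.lookup∘tabulate inner v with v ∈? T₀
      ... | yes v∈T₀ = contradiction v∈T₀ v∉T₀
      ... | no _     = refl

      q₂₀-inside : ∀ {v} → v ∈ T₀ → lookup q₂₀ v ≡ nothing
      q₂₀-inside {v} v∈T₀ rewrite VecP.lookup∘tabulate outer v with v ∈? T₀
      ... | yes _    = refl
      ... | no v∉T₀  = contradiction v∈T₀ v∉T₀

      q₂₀-outside : ∀ {v} → v ∉ T₀ → lookup q₂₀ v ≡ lookup p v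
      q₂₀-outside {v} v∉T₀ rewrite VecP.lookup∘tabulate outer v with v ∈? T₀
      ... | yes v∈T₀ = contradiction v∈T₀ v∉T₀
      ... | no _     = refl

      q₁₀-edge : ∀ {v u} → lookup q₁₀ v ≡ just u → v ∈ T₀ × lookup p v ≡ just u × u ≢ r₀
      q₁₀-edge {v} q₁₀v≡u with v ∈? T₀
      ... | yes v∈T₀ = v∈T₀ , strip-just (trans (sym (q₁₀-inside v∈T₀)) q₁₀v≡u)
      ... | no v∉T₀ with () ← trans (sym (q₁₀-outside v∉T₀)) q₁₀v≡u

      q₂₀-edge : ∀ {v u} → lookup q₂₀ v ≡ just u → v ∉ T₀ × lookup p v ≡ just u
      q₂₀-edge {v} q₂₀v≡u with v ∈? T₀
      ... | yes v∈T₀ with () ← trans (sym (q₂₀-inside v∈T₀)) q₂₀v≡u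
      ... | no v∉T₀  = v∉T₀ , trans (sym (q₂₀-outside v∉T₀)) q₂₀v≡u

      r₀∈T₀ : r₀ ∈ T₀
      r₀∈T₀ = Equivalence.from (∈T₀⇔ r₀) here

      T₀⊆S : T₀ ⊆ S
      T₀⊆S {v} v∈T₀ = decidable-stable (v ∈? S) λ v∉S →
        v∉S (subst (_∈ S) (sym (⇝-from-root (outside-root forestₚ v∉S) (Equivalence.to (∈T₀⇔ v) v∈T₀))) (⇝-within forestₚ s∈S s⇝r₀))

      T₀-parent : ∀ {v} → v ∈ T₀ → v ≢ r₀ → ∃ λ w → lookup p v ≡ just w
      T₀-parent {v} v∈T₀ v≢r₀ with lookup p v in pv
      ... | just w  = w , refl
      ... | nothing = contradiction (⇝-from-root pv (Equivalence.to (∈T₀⇔ v) v∈T₀)) v≢r₀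

      forest₁ : ForestOn (T₀ ─ ⁅ r₀ ⁆) q₁₀
      forest₁ = edges , λ v → pruned-rooted (λ _ e → proj₁ (proj₂ (q₁₀-edge e))) (proj₂ forestₚ v)
        where
        edges : ∀ v → EdgeWithin (T₀ ─ ⁅ r₀ ⁆) v (lookup q₁₀ v)
        edges v with lookup q₁₀ v in q₁₀v
        ... | nothing = tt
        ... | just u with v∈T₀ , pv≡u , u≢r₀ ← q₁₀-edge q₁₀v =
          x∈p∧x≢y⇒x∈p-y v∈T₀ v≢r₀ ,
          x∈p∧x≢y⇒x∈p-y (Equivalence.from (∈T₀⇔ u) (⇝-step (Equivalence.to (∈T₀⇔ v) v∈T₀) v≢r₀ pv≡u)) u≢r₀
          where
          v≢r₀ : v ≢ r₀
          v≢r₀ refl with () ← trans (sym r₀-root) pv≡u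

      forest₂ : ForestOn (S ─ T₀) q₂₀
      forest₂ = edges , λ v → pruned-rooted (λ _ e → proj₂ (q₂₀-edge e)) (proj₂ forestₚ v)
        where
        edges : ∀ v → EdgeWithin (S ─ T₀) v (lookup q₂₀ v)
        edges v with lookup q₂₀ v in q₂₀v
        ... | nothing = tt
        ... | just u with v∉T₀ , pv≡u ← q₂₀-edge q₂₀v with v∈S , u∈S ← edge-within forestₚ pv≡u =
          x∈p∧x∉q⇒x∈p─q v∈S v∉T₀ ,
          x∈p∧x∉q⇒x∈p─q u∈S (λ u∈T₀ → v∉T₀ (Equivalence.from (∈T₀⇔ v) (there pv≡u (Equivalence.to (∈T₀⇔ u) u∈T₀))))

      valid₀ : Valid S s d₀
      valid₀ = Equivalence.from (∈T₀⇔ s) s⇝r₀ , T₀⊆S , r₀∈T₀ , forest₁ , forest₂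

      graft₀ : graftᵈ d₀ ≡ p
      graft₀ = lookup-ext _ p at
        where
        at : ∀ v → lookup (graftᵈ d₀) v ≡ lookup p v
        at v with v FinP.≟ r₀ | v ∈? T₀
        ... | yes refl | _       = trans graft-root (sym r₀-root)
        ... | no v≢r₀  | yes v∈T₀ with w , pv≡w ← T₀-parent v∈T₀ v≢r₀ = begin
          lookup (graftᵈ d₀) v                     ≡⟨ graft-inside v≢r₀ v∈T₀ ⟩
          just (fromMaybe r₀ (lookup q₁₀ v))       ≡⟨ cong (just ∘ fromMaybe r₀) (trans (q₁₀-inside v∈T₀) (cong strip pv≡w)) ⟩
          just (fromMaybe r₀ (strip (just w)))     ≡⟨ fromMaybe-strip w ⟩
          just w                                   ≡⟨ pv≡w ⟨
          lookup p v                               ∎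
          where open ≡-Reasoning
        ... | no _     | no v∉T₀ = trans (graft-outside r₀∈T₀ v∉T₀) (q₂₀-outside v∉T₀)

      module _ {T : Subset N} {r : Fin N} {q₁ q₂ : Parent} (valid : Valid S s (T , r , q₁ , q₂))
               (graft≡p : graft T r q₁ q₂ ≡ p) where

        private
          module G = Graft (proj₁ (proj₂ valid)) (proj₁ (proj₂ (proj₂ valid)))
                           (proj₁ (proj₂ (proj₂ (proj₂ valid)))) (proj₂ (proj₂ (proj₂ (proj₂ valid))))

          ⇝-to-p : ∀ {v u} → graft T r q₁ q₂ ⊢ v ⇝ u → p ⊢ v ⇝ u
          ⇝-to-p = subst (λ b → b ⊢ _ ⇝ _) graft≡p

          ⇝-from-p : ∀ {v u} → p ⊢ v ⇝ u → graft T r q₁ q₂ ⊢ v ⇝ u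
          ⇝-from-p = subst (λ b → b ⊢ _ ⇝ _) (sym graft≡p)

          lookup-p : ∀ v → lookup p v ≡ lookup (graft T r q₁ q₂) v
          lookup-p v = cong (λ b → lookup b v) (sym graft≡p)

        root-unique : r ≡ r₀
        root-unique = ⇝-root-unique (⇝-to-p (G.inside⇝r (proj₁ valid))) s⇝r₀ (trans (lookup-p r) graft-root) r₀-root

        tree-unique : T ≡ T₀
        tree-unique = ⊆-antisym
          (λ {v} v∈T → Equivalence.from (∈T₀⇔ v) (subst (p ⊢ v ⇝_) root-unique (⇝-to-p (G.inside⇝r v∈T))))
          (λ {v} v∈T₀ → Equivalence.to (G.⇝r⇔inside v) (⇝-from-p (subst (p ⊢ v ⇝_) (sym root-unique) (Equivalence.to (∈T₀⇔ v) v∈T₀))))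

      q₁-unique : ∀ {q₁ q₂} → Valid S s (T₀ , r₀ , q₁ , q₂) → graft T₀ r₀ q₁ q₂ ≡ p → q₁ ≡ q₁₀
      q₁-unique {q₁} (_ , _ , _ , forest₁′ , _) graft≡p = lookup-ext q₁ q₁₀ at
        where
        at : ∀ v → lookup q₁ v ≡ lookup q₁₀ v
        at v with v ∈? T₀
        ... | no v∉T₀ = trans (outside-root forest₁′ (v∉T₀ ∘ proj₁ ∘ ∈-delete)) (sym (q₁₀-outside v∉T₀))
        ... | yes v∈T₀ with v FinP.≟ r₀
        ...   | yes refl = trans (outside-root forest₁′ (λ r₀∈ → proj₂ (∈-delete r₀∈) refl))
                                 (sym (trans (q₁₀-inside v∈T₀) (cong strip (trans (cong (λ b → lookup b r₀) (sym graft≡p)) graft-root))))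
        ...   | no v≢r₀  = sym (begin
          lookup q₁₀ v                               ≡⟨ q₁₀-inside v∈T₀ ⟩
          strip (lookup p v)                         ≡⟨ cong strip (trans (cong (λ b → lookup b v) (sym graft≡p)) (graft-inside v≢r₀ v∈T₀)) ⟩
          strip (just (fromMaybe r₀ (lookup q₁ v)))
            ≡⟨ strip-fromMaybe (lookup q₁ v) (λ q₁v≡u → proj₂ (∈-delete (proj₂ (edge-within forest₁′ q₁v≡u)))) ⟩
          lookup q₁ v                                ∎)
          where open ≡-Reasoning

      q₂-unique : ∀ {q₁ q₂} → Valid S s (T₀ , r₀ , q₁ , q₂) → graft T₀ r₀ q₁ q₂ ≡ p → q₂ ≡ q₂₀
      q₂-unique {q₂ = q₂} (_ , _ , _ , _ , forest₂′) graft≡p = lookup-ext q₂ q₂₀ at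
        where
        at : ∀ v → lookup q₂ v ≡ lookup q₂₀ v
        at v with v ∈? T₀
        ... | yes v∈T₀ = trans (outside-root forest₂′ (λ v∈ → x∈p─q⇒x∉q v∈ v∈T₀)) (sym (q₂₀-inside v∈T₀))
        ... | no v∉T₀  = sym (trans (q₂₀-outside v∉T₀) (trans (cong (λ b → lookup b v) (sym graft≡p)) (graft-outside r₀∈T₀ v∉T₀)))

      unique : ∀ d → Valid S s d → graftᵈ d ≡ p → d ≡ d₀
      unique (T , r , q₁ , q₂) valid graft≡p with refl ← root-unique valid graft≡p with refl ← tree-unique valid graft≡p =
        cong₂ (λ q₁ q₂ → T₀ , r₀ , q₁ , q₂) (q₁-unique valid graft≡p) (q₂-unique valid graft≡p)

      unique-decomposition : ∃ λ d₀ → ∀ d → (Valid S s d × graftᵈ d ≡ p) ⇔ d ≡ d₀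
      unique-decomposition = d₀ , λ d → mk⇔ (uncurry (unique d)) (λ { refl → valid₀ , graft₀ })

  -- The recurrence for weighted forest sums

  module ForestSum (N : ℕ) (z : ℚ) (z+j≢0 : ∀ j → 1 ≤ j → j ℕ.+ 2 ≤ N → z + ℕ→ℚ j ≢ 0ℚ) where

    open Forests N

    _≟ᴾ_ : DecidableEquality Parent
    _≟ᴾ_ = VecP.≡-dec _≟M_

    parents-enumerates : Enumerates _≟ᴾ_ (allParentFns N)
    parents-enumerates = allVecs-enumerates _≟M_ (maybe-enumerates FinP._≟_ {allFin N} (allFin-enumerates N)) N

    decompositions : List Decomposition
    decompositions = cartesianProduct (allSubsets N) (cartesianProduct (allFin N) (cartesianProduct (allParentFns N) (allParentFns N)))

    _≟ᴰ_ : DecidableEquality Decomposition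
    _≟ᴰ_ = ×P.≡-dec (VecP.≡-dec BoolP._≟_) (×P.≡-dec FinP._≟_ (×P.≡-dec _≟ᴾ_ _≟ᴾ_))

    decompositions-enumerates : Enumerates _≟ᴰ_ decompositions
    decompositions-enumerates =
      cartesianProduct-enumerates _ _ {allSubsets N} (allSubsets-enumerates N)
        (cartesianProduct-enumerates _ _ {allFin N} (allFin-enumerates N)
          (cartesianProduct-enumerates _≟ᴾ_ _≟ᴾ_ {allParentFns N} {allParentFns N} parents-enumerates parents-enumerates))

    weight : Subset N → Parent → ℚ
    weight S p = ∏ (allFin N) (λ u → hookWeight z (hook p u) ^⟦ u ∈? S ⟧)

    forestTerm : Subset N → Parent → ℚ
    forestTerm S p = 𝟙 (forestOn? S p) * weight S p

    forestSum : Subset N → ℚ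
    forestSum S = ∑ (allParentFns N) (forestTerm S)

    treeWeight : Subset N → Fin N → Subset N → Fin N → ℚ
    treeWeight S s T r = 𝟙 (s ∈? T) * (𝟙 (T ⊆? S) * (𝟙 (r ∈? T) * hookWeight z ∣ T ∣))

    weight-graft : ∀ {S s T r q₁ q₂} → Valid S s (T , r , q₁ , q₂) →
                   weight S (graft T r q₁ q₂) ≡ hookWeight z ∣ T ∣ * (weight (T ─ ⁅ r ⁆) q₁ * weight (S ─ T) q₂)
    weight-graft {S} {s} {T} {r} {q₁} {q₂} (_ , T⊆S , r∈T , forest₁ , forest₂) = begin
      weight S (graft T r q₁ q₂)
        ≡⟨ ∏-cong (allFin N) factor ⟩
      ∏ (allFin N) (λ u → atRoot u * (below u * beside u))
        ≡⟨ ∏-* (allFin N) atRoot (λ u → below u * beside u) ⟩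
      ∏ (allFin N) atRoot * ∏ (allFin N) (λ u → below u * beside u)
        ≡⟨ cong₂ _*_ (∏-allFin-single N r _ atRoot (λ u u≢r → ^⟦⟧-no _ (u FinP.≟ r) u≢r) (^⟦⟧-yes _ (r FinP.≟ r) refl))
                     (∏-* (allFin N) below beside) ⟩
      hookWeight z ∣ T ∣ * (weight (T ─ ⁅ r ⁆) q₁ * weight (S ─ T) q₂) ∎
      where
      open ≡-Reasoning
      open Graft T⊆S r∈T forest₁ forest₂
      atRoot below beside : Fin N → ℚ
      atRoot u = hookWeight z ∣ T ∣ ^⟦ u FinP.≟ r ⟧
      below  u = hookWeight z (hook q₁ u) ^⟦ u ∈? T ─ ⁅ r ⁆ ⟧
      beside u = hookWeight z (hook q₂ u) ^⟦ u ∈? S ─ T ⟧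
      factor : ∀ u → hookWeight z (hook (graft T r q₁ q₂) u) ^⟦ u ∈? S ⟧ ≡ atRoot u * (below u * beside u)
      factor u with u FinP.≟ r | u ∈? T
      ... | yes refl | _ = begin
        hookWeight z (hook (graft T r q₁ q₂) r) ^⟦ r ∈? S ⟧  ≡⟨ ^⟦⟧-yes _ (r ∈? S) (T⊆S r∈T) ⟩
        hookWeight z (hook (graft T r q₁ q₂) r)             ≡⟨ cong (hookWeight z) hook-root ⟩
        hookWeight z ∣ T ∣                                  ≡⟨ solve 1 (λ x → x := x :* (con 1ℚ :* con 1ℚ)) refl _ ⟩
        hookWeight z ∣ T ∣ * (1ℚ * 1ℚ)                      ≡⟨ cong (hookWeight z ∣ T ∣ *_) (cong₂ _*_
                                                                 (^⟦⟧-no _ (r ∈? T ─ ⁅ r ⁆) (λ r∈ → proj₂ (∈-delete r∈) refl))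
                                                                 (^⟦⟧-no _ (r ∈? S ─ T) (λ r∈ → x∈p─q⇒x∉q r∈ r∈T))) ⟨
        hookWeight z ∣ T ∣ * (below r * beside r)           ∎
      ... | no u≢r | yes u∈T = begin
        hookWeight z (hook (graft T r q₁ q₂) u) ^⟦ u ∈? S ⟧  ≡⟨ ^⟦⟧-yes _ (u ∈? S) (T⊆S u∈T) ⟩
        hookWeight z (hook (graft T r q₁ q₂) u)             ≡⟨ cong (hookWeight z) (hook-inside u∈T u≢r) ⟩
        hookWeight z (hook q₁ u)                            ≡⟨ ^⟦⟧-yes _ (u ∈? T ─ ⁅ r ⁆) (x∈p∧x≢y⇒x∈p-y u∈T u≢r) ⟨
        below u                                             ≡⟨ solve 1 (λ x → x := con 1ℚ :* (x :* con 1ℚ)) refl (below u) ⟩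
        1ℚ * (below u * 1ℚ)                                 ≡⟨ cong (λ t → 1ℚ * (below u * t)) (^⟦⟧-no _ (u ∈? S ─ T) (λ u∈ → x∈p─q⇒x∉q u∈ u∈T)) ⟨
        1ℚ * (below u * beside u)                           ∎
      ... | no u≢r | no u∉T = begin
        hookWeight z (hook (graft T r q₁ q₂) u) ^⟦ u ∈? S ⟧  ≡⟨ cong (λ h → hookWeight z h ^⟦ u ∈? S ⟧) (hook-outside u∉T) ⟩
        hookWeight z (hook q₂ u) ^⟦ u ∈? S ⟧                 ≡⟨ ^⟦⟧-⇔ _ (u ∈? S) (u ∈? S ─ T) (mk⇔ (λ u∈S → x∈p∧x∉q⇒x∈p─q u∈S u∉T) (p─q⊆p S T)) ⟩
        beside u                                            ≡⟨ solve 1 (λ x → x := con 1ℚ :* (con 1ℚ :* x)) refl (beside u) ⟩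
        1ℚ * (1ℚ * beside u)                                ≡⟨ cong (λ t → 1ℚ * (t * beside u)) (^⟦⟧-no _ (u ∈? T ─ ⁅ r ⁆) (u∉T ∘ proj₁ ∘ ∈-delete)) ⟨
        1ℚ * (below u * beside u)                           ∎

    forestSum-empty : ∀ {S} → (∀ v → v ∉ S) → forestSum S ≡ 1ℚ
    forestSum-empty {S} empty = begin
      forestSum S                                                 ≡⟨ ∑-cong (allParentFns N) only-isolated ⟩
      ∑ (allParentFns N) (λ p → 𝟙 (p ≟ᴾ isolated) * 1ℚ)           ≡⟨ ∑-δ _≟ᴾ_ (allParentFns N) parents-enumerates isolated (λ _ → 1ℚ) ⟩
      1ℚ                                                          ∎
      where
      open ≡-Reasoning
      isolated : Parent
      isolated = Vec.replicate N nothing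
      forest⇔isolated : ∀ p → ForestOn S p ⇔ p ≡ isolated
      forest⇔isolated p = mk⇔
        (λ forest → lookup-ext p isolated (λ v → trans (outside-root forest (empty v)) (sym (VecP.lookup-replicate v nothing))))
        (λ { refl → (λ v → subst (EdgeWithin S v) (sym (VecP.lookup-replicate v nothing)) tt)
                  , (λ v → root (VecP.lookup-replicate v nothing)) })
      only-isolated : ∀ p → forestTerm S p ≡ 𝟙 (p ≟ᴾ isolated) * 1ℚ
      only-isolated p = cong₂ _*_ (𝟙-⇔ (forestOn? S p) (p ≟ᴾ isolated) (forest⇔isolated p))
                                  (trans (∏-cong (allFin N) (λ u → ^⟦⟧-no _ (u ∈? S) (empty u))) (∏-one (allFin N)))

    ∑-decompositions : ∀ f → ∑ decompositions f ≡
      ∑ (allSubsets N) (λ T → ∑ (allFin N) (λ r → ∑ (allParentFns N) (λ q₁ → ∑ (allParentFns N) (λ q₂ → f (T , r , q₁ , q₂)))))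
    ∑-decompositions f =
      trans (∑-cartesianProduct (allSubsets N) _ f) (∑-cong (allSubsets N) (λ T →
      trans (∑-cartesianProduct (allFin N) _ _) (∑-cong (allFin N) (λ r →
      ∑-cartesianProduct (allParentFns N) (allParentFns N) _))))

    forestTerm-graft : ∀ {S s} T r q₁ q₂ → 𝟙 (valid? S s (T , r , q₁ , q₂)) * weight S (graft T r q₁ q₂) ≡
                       treeWeight S s T r * (forestTerm (T ─ ⁅ r ⁆) q₁ * forestTerm (S ─ T) q₂)
    forestTerm-graft {S} {s} T r q₁ q₂ = begin
      𝟙 V * weight S (graft T r q₁ q₂)
        ≡⟨ 𝟙-guard V weight-graft ⟩
      𝟙 V * (hookWeight z ∣ T ∣ * (weight U q₁ * weight W q₂))
        ≡⟨ cong (_* (hookWeight z ∣ T ∣ * (weight U q₁ * weight W q₂))) indicators ⟩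
      𝟙 a * (𝟙 b * (𝟙 c * (𝟙 f₁ * 𝟙 f₂))) * (hookWeight z ∣ T ∣ * (weight U q₁ * weight W q₂))
        ≡⟨ solve 8 (λ a b c f₁ f₂ h w₁ w₂ → a :* (b :* (c :* (f₁ :* f₂))) :* (h :* (w₁ :* w₂))
                                          := a :* (b :* (c :* h)) :* ((f₁ :* w₁) :* (f₂ :* w₂)))
                 refl (𝟙 a) (𝟙 b) (𝟙 c) (𝟙 f₁) (𝟙 f₂) (hookWeight z ∣ T ∣) (weight U q₁) (weight W q₂) ⟩
      treeWeight S s T r * (forestTerm U q₁ * forestTerm W q₂) ∎
      where
      open ≡-Reasoning
      U W : Subset N
      U = T ─ ⁅ r ⁆
      W = S ─ T
      a : Dec (s ∈ T)
      a = s ∈? T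
      b : Dec (T ⊆ S)
      b = T ⊆? S
      c : Dec (r ∈ T)
      c = r ∈? T
      f₁ : Dec (ForestOn U q₁)
      f₁ = forestOn? U q₁
      f₂ : Dec (ForestOn W q₂)
      f₂ = forestOn? W q₂
      V : Dec (Valid S s (T , r , q₁ , q₂))
      V = valid? S s (T , r , q₁ , q₂)
      indicators : 𝟙 V ≡ 𝟙 a * (𝟙 b * (𝟙 c * (𝟙 f₁ * 𝟙 f₂)))
      indicators = trans (𝟙-× a (b ×-dec c ×-dec f₁ ×-dec f₂)) (cong (𝟙 a *_) (trans (𝟙-× b (c ×-dec f₁ ×-dec f₂))
                     (cong (𝟙 b *_) (trans (𝟙-× c (f₁ ×-dec f₂)) (cong (𝟙 c *_) (𝟙-× f₁ f₂))))))

    forestSum-recurrence : ∀ {S s} → s ∈ S →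
      forestSum S ≡ ∑ (allSubsets N) (λ T → ∑ (allFin N) (λ r → treeWeight S s T r * (forestSum (T ─ ⁅ r ⁆) * forestSum (S ─ T))))
    forestSum-recurrence {S} {s} s∈S = begin
      forestSum S
        ≡⟨ ∑-reindex _≟ᴾ_ _≟ᴰ_ (allParentFns N) decompositions parents-enumerates decompositions-enumerates
                     (forestOn? S) (valid? S s) graftᵈ (λ {d} → graft-forest d)
                     (λ forest → Decompose.unique-decomposition forest s∈S) (weight S) ⟩
      ∑ decompositions (λ d → 𝟙 (valid? S s d) * weight S (graftᵈ d))
        ≡⟨ ∑-cong decompositions (λ { (T , r , q₁ , q₂) → forestTerm-graft {S} {s} T r q₁ q₂ }) ⟩
      ∑ decompositions (λ { (T , r , q₁ , q₂) → treeWeight S s T r * (forestTerm (T ─ ⁅ r ⁆) q₁ * forestTerm (S ─ T) q₂) })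
        ≡⟨ ∑-decompositions _ ⟩
      ∑ (allSubsets N) (λ T → ∑ (allFin N) (λ r → ∑ (allParentFns N) (λ q₁ → ∑ (allParentFns N) (λ q₂ →
          treeWeight S s T r * (forestTerm (T ─ ⁅ r ⁆) q₁ * forestTerm (S ─ T) q₂)))))
        ≡⟨ ∑-cong (allSubsets N) (λ T → ∑-cong (allFin N) (λ r → factor-sums T r)) ⟩
      ∑ (allSubsets N) (λ T → ∑ (allFin N) (λ r → treeWeight S s T r * (forestSum (T ─ ⁅ r ⁆) * forestSum (S ─ T)))) ∎
      where
      open ≡-Reasoning
      factor-sums : ∀ T r → ∑ (allParentFns N) (λ q₁ → ∑ (allParentFns N) (λ q₂ →
                              treeWeight S s T r * (forestTerm (T ─ ⁅ r ⁆) q₁ * forestTerm (S ─ T) q₂)))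
                            ≡ treeWeight S s T r * (forestSum (T ─ ⁅ r ⁆) * forestSum (S ─ T))
      factor-sums T r = begin
        ∑ (allParentFns N) (λ q₁ → ∑ (allParentFns N) (λ q₂ → c * (forestTerm (T ─ ⁅ r ⁆) q₁ * forestTerm (S ─ T) q₂)))
          ≡⟨ ∑-cong (allParentFns N) (λ q₁ → *-∑ (allParentFns N) c _) ⟨
        ∑ (allParentFns N) (λ q₁ → c * ∑ (allParentFns N) (λ q₂ → forestTerm (T ─ ⁅ r ⁆) q₁ * forestTerm (S ─ T) q₂))
          ≡⟨ *-∑ (allParentFns N) c _ ⟨
        c * ∑ (allParentFns N) (λ q₁ → ∑ (allParentFns N) (λ q₂ → forestTerm (T ─ ⁅ r ⁆) q₁ * forestTerm (S ─ T) q₂))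
          ≡⟨ cong (c *_) (∑-*-∑ (allParentFns N) (allParentFns N) (forestTerm (T ─ ⁅ r ⁆)) (forestTerm (S ─ T))) ⟨
        c * (forestSum (T ─ ⁅ r ⁆) * forestSum (S ─ T)) ∎
        where
        c : ℚ
        c = treeWeight S s T r

    treeWeight-guard : ∀ {S s T r X Y} → (s ∈ T → T ⊆ S → r ∈ T → X ≡ Y) → treeWeight S s T r * X ≡ treeWeight S s T r * Y
    treeWeight-guard {S} {s} {T} {r} {X} {Y} X≡Y = begin
      treeWeight S s T r * X                                       ≡⟨ reassociate X ⟩
      𝟙 (s ∈? T) * (𝟙 (T ⊆? S) * (𝟙 (r ∈? T) * (hookWeight z ∣ T ∣ * X)))
        ≡⟨ 𝟙-guard (s ∈? T) (λ s∈T → 𝟙-guard (T ⊆? S) (λ T⊆S → 𝟙-guard (r ∈? T) (λ r∈T →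
             cong (hookWeight z ∣ T ∣ *_) (X≡Y s∈T T⊆S r∈T)))) ⟩
      𝟙 (s ∈? T) * (𝟙 (T ⊆? S) * (𝟙 (r ∈? T) * (hookWeight z ∣ T ∣ * Y))) ≡⟨ reassociate Y ⟨
      treeWeight S s T r * Y                                       ∎
      where
      open ≡-Reasoning
      reassociate : ∀ x → treeWeight S s T r * x ≡ 𝟙 (s ∈? T) * (𝟙 (T ⊆? S) * (𝟙 (r ∈? T) * (hookWeight z ∣ T ∣ * x)))
      reassociate = solve 5 (λ a b c h x → a :* (b :* (c :* h)) :* x := a :* (b :* (c :* (h :* x))))
                          refl (𝟙 (s ∈? T)) (𝟙 (T ⊆? S)) (𝟙 (r ∈? T)) (hookWeight z ∣ T ∣)

    size-hookWeight : ∀ k → 1 ≤ k → k ≤ N → ℕ→ℚ k * (hookWeight z k * z ↑ (k ∸ 1)) ≡ z * 1ℚ ↑ (k ∸ 1)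
    size-hookWeight (suc k) _ k<N = begin
      ℕ→ℚ (suc k) * (hookWeight z (suc k) * z ↑ k)   ≡⟨ ℚP.*-assoc (ℕ→ℚ (suc k)) _ _ ⟨
      ℕ→ℚ (suc k) * hookWeight z (suc k) * z ↑ k     ≡⟨ cong (_* z ↑ k) (ℚP.*-comm (ℕ→ℚ (suc k)) (hookWeight z (suc k))) ⟩
      hookWeight z (suc k) * ℕ→ℚ (suc k) * z ↑ k     ≡⟨ ℚP.*-assoc (hookWeight z (suc k)) _ _ ⟩
      hookWeight z (suc k) * (ℕ→ℚ (suc k) * z ↑ k)   ≡⟨ hookWeight-↑ z k (λ j 1≤j j<k → z+j≢0 j 1≤j (j+2≤N j<k)) ⟩
      z * ℕ→ℚ (k !)                                   ≡⟨ cong (z *_) (1↑≡! k) ⟨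
      z * 1ℚ ↑ k                                      ∎
      where
      open ≡-Reasoning
      j+2≤N : ∀ {j} → suc j ≤ k → j ℕ.+ 2 ≤ N
      j+2≤N {j} j<k = ℕP.≤-trans (ℕP.≤-reflexive (ℕP.+-comm j 2)) (ℕP.≤-trans (s≤s j<k) k<N)

    ∑-roots : ∀ {S s} T Y → ∑ (allFin N) (λ r → treeWeight S s T r * (z ↑ (∣ T ∣ ∸ 1) * Y)) ≡
                           z * (𝟙 (s ∈? T) * (𝟙 (T ⊆? S) * (1ℚ ↑ (∣ T ∣ ∸ 1) * Y)))
    ∑-roots {S} {s} T Y = begin
      ∑ (allFin N) (λ r → treeWeight S s T r * (z ↑ (∣ T ∣ ∸ 1) * Y))
        ≡⟨ ∑-cong (allFin N) (λ r → solve 6 (λ a b c h x y → a :* (b :* (c :* h)) :* (x :* y) := c :* (a :* (b :* (h :* x :* y))))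
                                           refl (𝟙 (s ∈? T)) (𝟙 (T ⊆? S)) (𝟙 (r ∈? T)) (hookWeight z ∣ T ∣) (z ↑ (∣ T ∣ ∸ 1)) Y) ⟩
      ∑ (allFin N) (λ r → 𝟙 (r ∈? T) * rest)
        ≡⟨ ∑-* (allFin N) rest (λ r → 𝟙 (r ∈? T)) ⟨
      ∑ (allFin N) (λ r → 𝟙 (r ∈? T)) * rest
        ≡⟨ cong (_* rest) (∑-𝟙∈≡∣∣ T) ⟩
      ℕ→ℚ ∣ T ∣ * rest
        ≡⟨ solve 5 (λ n a b h y → n :* (a :* (b :* (h :* y))) := a :* (b :* (n :* h :* y)))
                 refl (ℕ→ℚ ∣ T ∣) (𝟙 (s ∈? T)) (𝟙 (T ⊆? S)) (hookWeight z ∣ T ∣ * z ↑ (∣ T ∣ ∸ 1)) Y ⟩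
      𝟙 (s ∈? T) * (𝟙 (T ⊆? S) * (ℕ→ℚ ∣ T ∣ * (hookWeight z ∣ T ∣ * z ↑ (∣ T ∣ ∸ 1)) * Y))
        ≡⟨ 𝟙-guard (s ∈? T) (λ s∈T → cong (λ t → 𝟙 (T ⊆? S) * (t * Y)) (size-hookWeight ∣ T ∣ (x∈p⇒∣p∣≥1 s∈T) (∣p∣≤n T))) ⟩
      𝟙 (s ∈? T) * (𝟙 (T ⊆? S) * (z * 1ℚ ↑ (∣ T ∣ ∸ 1) * Y))
        ≡⟨ solve 5 (λ a b c x y → a :* (b :* (c :* x :* y)) := c :* (a :* (b :* (x :* y))))
                 refl (𝟙 (s ∈? T)) (𝟙 (T ⊆? S)) z (1ℚ ↑ (∣ T ∣ ∸ 1)) Y ⟩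
      z * (𝟙 (s ∈? T) * (𝟙 (T ⊆? S) * (1ℚ ↑ (∣ T ∣ ∸ 1) * Y))) ∎
      where
      open ≡-Reasoning
      rest : ℚ
      rest = 𝟙 (s ∈? T) * (𝟙 (T ⊆? S) * (hookWeight z ∣ T ∣ * z ↑ (∣ T ∣ ∸ 1) * Y))

    forestSum-step : ∀ {S s} → s ∈ S → (∀ U → ∣ U ∣ < ∣ S ∣ → forestSum U ≡ z ↑ ∣ U ∣) → forestSum S ≡ z ↑ ∣ S ∣
    forestSum-step {S} {s} s∈S smaller = begin
      forestSum S
        ≡⟨ forestSum-recurrence s∈S ⟩
      ∑ (allSubsets N) (λ T → ∑ (allFin N) (λ r → treeWeight S s T r * (forestSum (T ─ ⁅ r ⁆) * forestSum (S ─ T))))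
        ≡⟨ ∑-cong (allSubsets N) (λ T → ∑-cong (allFin N) (λ r → treeWeight-guard (induction T r))) ⟩
      ∑ (allSubsets N) (λ T → ∑ (allFin N) (λ r → treeWeight S s T r * (z ↑ (∣ T ∣ ∸ 1) * z ↑ ∣ S ─ T ∣)))
        ≡⟨ ∑-cong (allSubsets N) (λ T → ∑-roots {S} {s} T (z ↑ ∣ S ─ T ∣)) ⟩
      ∑ (allSubsets N) (λ T → z * (𝟙 (s ∈? T) * (𝟙 (T ⊆? S) * (1ℚ ↑ (∣ T ∣ ∸ 1) * z ↑ ∣ S ─ T ∣))))
        ≡⟨ *-∑ (allSubsets N) z _ ⟨
      z * ∑ (allSubsets N) (λ T → 𝟙 (s ∈? T) * (𝟙 (T ⊆? S) * (1ℚ ↑ (∣ T ∣ ∸ 1) * z ↑ ∣ S ─ T ∣)))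
        ≡⟨ cong (z *_) (↑-vandermonde-pointed s∈S 1ℚ z) ⟩
      z * (1ℚ + z) ↑ (∣ S ∣ ∸ 1)
        ≡⟨ cong (λ x → z * x ↑ (∣ S ∣ ∸ 1)) (ℚP.+-comm 1ℚ z) ⟩
      z * (z + 1ℚ) ↑ (∣ S ∣ ∸ 1)
        ≡⟨ ↑-pred z ∣ S ∣ (x∈p⇒∣p∣≥1 s∈S) ⟨
      z ↑ ∣ S ∣ ∎
      where
      open ≡-Reasoning
      induction : ∀ T r → s ∈ T → T ⊆ S → r ∈ T →
                  forestSum (T ─ ⁅ r ⁆) * forestSum (S ─ T) ≡ z ↑ (∣ T ∣ ∸ 1) * z ↑ ∣ S ─ T ∣
      induction T r s∈T T⊆S r∈T = cong₂ _*_
        (trans (smaller (T ─ ⁅ r ⁆) (ℕP.<-≤-trans (x∈p⇒∣p-x∣<∣p∣ r∈T) (p⊆q⇒∣p∣≤∣q∣ T⊆S))) (cong (z ↑_) (x∈p⇒∣p-x∣≡∣p∣∸1 r∈T)))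
        (smaller (S ─ T) (p∩q≢∅⇒∣p─q∣<∣p∣ S T (s , x∈p∩q⁺ (s∈S , s∈T))))

    forestSum≡↑ : ∀ S → forestSum S ≡ z ↑ ∣ S ∣
    forestSum≡↑ S = go S (<-wellFounded ∣ S ∣)
      where
      go : ∀ S → Acc _<_ ∣ S ∣ → forestSum S ≡ z ↑ ∣ S ∣
      go S (acc smaller) with nonempty? S
      ... | yes (s , s∈S) = forestSum-step s∈S (λ U ∣U∣<∣S∣ → go U (smaller ∣U∣<∣S∣))
      ... | no  empty     = trans (forestSum-empty (λ v v∈S → empty (v , v∈S)))
                                  (cong (z ↑_) (sym (trans (cong ∣_∣ (Empty-unique empty)) (∣⊥∣≡0 N))))

    lhs≡forestSum : lhs z N ≡ forestSum ⊤ˢ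
    lhs≡forestSum = trans (∑-filter _ (allParentFns N) _) (∑-cong (allParentFns N) λ p →
      cong₂ _*_ (𝟙-⇔ (isForest p BoolP.≟ true) (forestOn? ⊤ˢ p) (⇔.trans (isForest⇔Rooted p) (mk⇔ (everywhere {p} ,_) proj₂)))
                (∏-cong (allFin N) λ u → sym (^⟦⟧-yes _ (u ∈? ⊤ˢ) ∈⊤)))
      where
      everywhere : ∀ {p} v → EdgeWithin ⊤ˢ v (lookup p v)
      everywhere {p} v with lookup p v
      ... | nothing = tt
      ... | just _  = ∈⊤ , ∈⊤

open import Defs
open import Data.Nat using (ℕ; suc; _≤_; _+_)
open import Data.Rational using (ℚ; 0ℚ) renaming (_+_ to _+ℚ_)
open import Relation.Binary.PropositionalEquality using (_≡_; _≢_; cong; module ≡-Reasoning)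
open import Data.Fin.Subset using (∣_∣) renaming (⊤ to ⊤ˢ)
open import Data.Fin.Subset.Properties using (∣⊤∣≡n)
open HookLengthForests using (_↑_; rhs≡↑; module ForestSum)

theorem4p8 : (n : ℕ) → 1 ≤ n → (z : ℚ) →
    ((j : ℕ) → 1 ≤ j → j + 2 ≤ n → z +ℚ ℕ→ℚ j ≢ 0ℚ) →
    lhs z n ≡ rhs z n
theorem4p8 (suc m) _ z z+j≢0 = begin
  lhs z (suc m)         ≡⟨ lhs≡forestSum ⟩
  forestSum ⊤ˢ          ≡⟨ forestSum≡↑ ⊤ˢ ⟩
  z ↑ ∣ ⊤ˢ {suc m} ∣    ≡⟨ cong (z ↑_) (∣⊤∣≡n (suc m)) ⟩
  z ↑ suc m             ≡⟨ rhs≡↑ z m ⟨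
  rhs z (suc m)         ∎
  where
  open ≡-Reasoning
  open ForestSum (suc m) z z+j≢0
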